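{- Let $d\ge 1$ and $\mu\ge 1$. The competitive ratio of Move To Front for the MinUsageTime Dynamic Vector Bin Packing problem in $d$ dimensions is at least $\max\{2\mu,(\mu+1)d\}$; i.e., for every $\delta>0$ there is an instance $\mathcal{R}$ whose ratio of maximum to minimum item duration is $\mu$ such that $\mathsf{cost}(\mathrm{MF},\mathcal{R}) \ge (\max\{2\mu,(\mu+1)d\}-\delta)\,\mathsf{OPT}(\mathcal{R})$.
   Context: MinUsageTime Dynamic Vector Bin Packing (non-clairvoyant, online, no repacking): an instance is a finite list $\mathcal{R}$ of items; each item $r$ has arrival time $a(r)\ge 0$, departure time $e(r)>a(r)$, and size $\mathbf{s}(r)\in[0,1]^d$. Its active interval is $I(r)=[a(r),e(r))$ with duration $e(r)-a(r)$. Bins have capacity $1$ in each of the $d$ coordinates. Items are revealed in order of arrival (ties in a given order); on arrival, an item must be irrevocably placed into a bin such that the total size of items currently active in that bin stays $\le 1$ in every coordinate; the departure time is unknown at arrival. A bin is open while it contains an active item; once all its items have departed it is closed and never used again. If bin $B_i$ receives item set $R_i$, the cost of algorithm $\mathcal{A}$ is $\mathsf{cost}(\mathcal{A},\mathcal{R})=\sum_i \mathrm{span}(R_i)$, where $\mathrm{span}(S)$ is the Lebesgue measure of $\bigcup_{r\in S} I(r)$. $\mathsf{OPT}(\mathcal{R})=\int \mathsf{OPT}(\mathcal{R},t)\,dt$, where $\mathsf{OPT}(\mathcal{R},t)$ is the minimum number of unit-capacity bins into which the items active at time $t$ can be packed (offline, repacking allowed). Move To Front: maintains the list of open bins ordered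 by most recent use; an arriving item is placed into the first bin in the list that can accommodate it, and if none can, a new bin is opened; the bin receiving the item is then moved to the front of the list.
   Formalization: The parameters μ and δ range over the rationals, and the arrival times, departure times and sizes of the witness instance are taken in ℚ. -}

module Defs where

open import Data.Nat as ℕ using (ℕ; zero; suc)
open import Data.Integer using (+_)
open import Data.Rational using (ℚ; 0ℚ; 1ℚ; _+_; _*_; _-_; _≤_; _<_; _/_)
open import Data.Rational.Properties using (_≤?_; _<?_; ≤-decTotalOrder)
open import Data.List using (List; []; _∷_; map; foldr; foldl; length; concatMap; allFin)
open import Data.Bool.ListAction using (any; all)
open import Data.List.Membership.Propositional using (_∈_)
open import Data.List.Relation.Unary.All as LAll using ()
open import Data.List.Relation.Unary.Linked using (Linked)
open import Data.Vec as Vec using (Vec)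
open import Data.Vec.Relation.Unary.All as VAll using ()
open import Data.Bool using (Bool; true; false; _∧_; if_then_else_)
open import Data.Fin using (Fin)
import Data.Fin as Fin
open import Data.Maybe using (Maybe; just; nothing; maybe′)
open import Data.Product using (_×_; _,_; ∃-syntax)
open import Relation.Nullary.Decidable using (⌊_⌋)
open import Relation.Binary.PropositionalEquality using (_≡_)
import Data.List.Sort.MergeSort.Base as MS

private variable d : ℕ

-- Items: arrival time, departure time, d-dimensional size.
-- Active interval is [arr, dep).

record Item (d : ℕ) : Set where
  constructor item
  field
    arr  : ℚ
    dep  : ℚ
    size : Vec ℚ d
open Item public

duration : Item d → ℚ
duration r = dep r - arr r

ValidItem : Item d → Set
ValidItem r = (0ℚ ≤ arr r) × (arr r < dep r)
              × VAll.All (λ x → (0ℚ ≤ x) × (x ≤ 1ℚ)) (size r)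

-- An instance is a finite list of items, listed in order of arrival
-- (ties are broken by the list order).
Instance : ℕ → Set
Instance d = List (Item d)

ValidInstance : Instance d → Set
ValidInstance R = LAll.All ValidItem R × Linked (λ r s → arr r ≤ arr s) R

DurationRatio : Instance d → ℚ → Set
DurationRatio R μ =
  (∀ {r s} → r ∈ R → s ∈ R → duration r ≤ μ * duration s)
  × (∃[ r ] ∃[ s ] (r ∈ R × s ∈ R × duration r ≡ μ * duration s))

sumℚ : List ℚ → ℚ
sumℚ = foldr _+_ 0ℚ

ℕtoℚ : ℕ → ℚ
ℕtoℚ n = + n / 1

filterB : {A : Set} → (A → Bool) → List A → List A
filterB p [] = []
filterB p (x ∷ xs) = if p x then x ∷ filterB p xs else filterB p xs

activeAt : ℚ → Item d → Bool
activeAt t r = ⌊ arr r ≤? t ⌋ ∧ ⌊ t <? dep r ⌋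

zeroV : Vec ℚ d
zeroV = Vec.replicate _ 0ℚ

addV : Vec ℚ d → Vec ℚ d → Vec ℚ d
addV = Vec.zipWith _+_

leOne : {n : ℕ} → Vec ℚ n → Bool
leOne Vec.[] = true
leOne (x Vec.∷ xs) = ⌊ x ≤? 1ℚ ⌋ ∧ leOne xs

sumV : List (Vec ℚ d) → Vec ℚ d
sumV = foldr addV zeroV

eventTimes : Instance d → List ℚ
eventTimes R = MS.sort ≤-decTotalOrder (concatMap (λ r → arr r ∷ dep r ∷ []) R)

sumSegs : (ℚ → ℚ → ℚ) → List ℚ → ℚ
sumSegs f (p ∷ q ∷ rest) = f p q + sumSegs f (q ∷ rest)
sumSegs f _ = 0ℚ

-- span(S): Lebesgue measure of ⋃_{r∈S} [arr r, dep r).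
-- Computed over the elementary segments between consecutive event times:
-- a segment [p,q) lies in the union iff some interval contains p.

span : List (Item d) → ℚ
span S = sumSegs (λ p q → if any (activeAt p) S then q - p else 0ℚ) (eventTimes S)

-- State: list of all bins ever opened (each bin = list of items it
-- received), ordered by most recent use (front = most recent).
-- A bin is open at time t iff it contains an item active at t; closed
-- bins (no active item) are never chosen again, since time only increases.

Bin : ℕ → Set
Bin d = List (Item d)

binOpenAt : ℚ → Bin d → Bool
binOpenAt t b = any (activeAt t) b

canAccept : Item d → Bin d → Bool
canAccept r b = binOpenAt (arr r) b
  ∧ leOne (addV (sumV (map size (filterB (activeAt (arr r)) b))) (size r))

place : Item d → List (Bin d) → Maybe (Bin d × List (Bin d))
place r [] = nothing
place r (b ∷ bs) =
  if canAccept r b then just (r ∷ b , bs)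
  else maybe′ (λ { (b′ , bs′) → just (b′ , b ∷ bs′) }) nothing (place r bs)

mfInsert : Item d → List (Bin d) → List (Bin d)
mfInsert r bins =
  maybe′ (λ { (b′ , rest) → b′ ∷ rest }) ((r ∷ []) ∷ bins) (place r bins)

runMF : Instance d → List (Bin d)
runMF R = foldl (λ bins r → mfInsert r bins) [] R

costMF : Instance d → ℚ
costMF R = sumℚ (map span (runMF R))

assignments : (m : ℕ) → ℕ → List (List (Fin m))
assignments m zero = [] ∷ []
assignments m (suc k) = concatMap (λ j → map (j ∷_) (assignments m k)) (allFin m)

loadOf : {m : ℕ} → Fin m → List (Fin m) → List (Vec ℚ d) → Vec ℚ d
loadOf j (i ∷ is) (v ∷ vs) =
  if ⌊ i Fin.≟ j ⌋ then addV v (loadOf j is vs) else loadOf j is vs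
loadOf j _ _ = zeroV

packable : ℕ → List (Vec ℚ d) → Bool
packable m vs = any (λ asg → all (λ j → leOne (loadOf j asg vs)) (allFin m))
                    (assignments m (length vs))

-- minimum number of bins: least m < length vs that is packable, else
-- length vs (always feasible for sizes in [0,1]^d: one item per bin)
optBins : List (Vec ℚ d) → ℕ
optBins vs = search 0 (length vs)
  where
  search : ℕ → ℕ → ℕ
  search m zero = m
  search m (suc fuel) = if packable m vs then m else search (suc m) fuel

optAt : Instance d → ℚ → ℕ
optAt R t = optBins (map size (filterB (activeAt t) R))

-- OPT(R) = ∫ OPT(R,t) dt ; OPT(R,t) is constant on each segment
-- [p,q) between consecutive event times and 0 outside [min, max).
OPT : Instance d → ℚ
OPT R = sumSegs (λ p q → (q - p) * ℕtoℚ (optAt R p)) (eventTimes R)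

-- Two families of instances, with item durations 1 and μ, force Move To Front to give every
-- (big, small) pair of items its own bin: the big item arrives first and fits into no existing
-- bin, the small one then fits next to it, and the bin stays open for the lifetime of the pair.
-- In dimension 1 the pairs are items of size ½ - ε (duration 1) and 4ε (duration μ): MF keeps 2M
-- bins open for time μ, whereas OPT packs two big items per bin and all small items together,
-- using M + 1 bins until time 1 and one bin afterwards, so the ratio tends to 2μ as M → ∞.
-- In dimension d the pairs are, for every coordinate c, an item of size 1 - 2ε in coordinate c
-- and a small filler, repeated in M blocks; at time s = 1 - 1/(M + 1) one item of size ε in
-- every coordinate and duration μ arrives per bin, and MF must put each into a different bin, so
-- Md bins stay open for s + μ while OPT needs M + 1 bins until time 1 and one bin afterwards;
-- the ratio tends to (μ + 1)d. OPT and the spans are computed exactly: the event times of each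
-- instance are known up to permutation, and sorting determines them.
module Submission where

open import Defs
open import Data.Nat using (ℕ)
open import Data.Rational using (ℚ; 0ℚ; 1ℚ; _+_; _*_; _-_; _≤_; _<_; _⊔_)
open import Data.Product using (_×_; ∃-syntax)
open import Data.Nat as ℕ using (zero; suc; z≤n; s≤s)
import Data.Nat.Properties as ℕP
import Data.Nat.Coprimality as Coprime
import Data.Integer as ℤ
import Data.Integer.Properties as ℤP
open import Data.Rational as ℚ using (mkℚ; 1/_; ½)
import Data.Rational.Properties as ℚP
import Data.Rational.Unnormalised as ℚᵘ
import Data.Rational.Unnormalised.Properties as ℚᵘP
open import Data.Rational.Solver using (module +-*-Solver)
open import Data.Bool using (Bool; true; false; _∧_; if_then_else_)
open import Data.Bool.Properties using (∧-zeroʳ)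
open import Data.Bool.ListAction using (any; all)
open import Data.Fin as Fin using (Fin)
import Data.Fin.Properties as FinP
open import Data.List using (List; []; _∷_; _++_; map; foldl; concat; concatMap; replicate; length; allFin; tabulate)
import Data.List.Properties as ListP
open import Data.List.Membership.Propositional using (_∈_)
import Data.List.Membership.Propositional.Properties as MemP
open import Data.List.Relation.Unary.All using (All; []; _∷_)
import Data.List.Relation.Unary.All as All
import Data.List.Relation.Unary.All.Properties as AllP
open import Data.List.Relation.Unary.Any using (here; there)
open import Data.List.Relation.Unary.Linked using (Linked; []; [-]; _∷_)
import Data.List.Relation.Unary.Linked.Properties as LinkedP
open import Data.List.Relation.Binary.Permutation.Propositional
  using (_↭_; ↭⇒↭ₛ; ↭-sym; ↭-trans; ↭-refl; ↭-reflexive; prep; swap)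
import Data.List.Relation.Binary.Permutation.Propositional.Properties as PermP
import Data.List.Relation.Binary.Pointwise as Pointwise
import Data.List.Relation.Unary.Sorted.TotalOrder.Properties as SortedP
import Data.List.Sort.MergeSort.Properties as MergeSortP
open import Data.Maybe using (just; nothing)
open import Data.Product using (_,_; proj₁; proj₂)
open import Data.Sum using (_⊎_; inj₁; inj₂)
open import Data.Unit using (⊤; tt)
open import Data.Vec as Vec using (Vec; lookup)
import Data.Vec.Properties as VecP
import Data.Vec.Relation.Unary.All as VecAll
import Data.Vec.Relation.Unary.All.Properties as VecAllP
open import Function using (const)
open import Relation.Binary.Bundles using (DecTotalOrder)
open import Relation.Binary.PropositionalEquality
open import Relation.Nullary using (Dec; yes; no; ¬_)
open import Relation.Nullary.Decidable using (⌊_⌋; dec-true; dec-false; isYes≗does)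

open +-*-Solver

private variable
  A : Set
  m n : ℕ

-- Rational arithmetic

ℕtoℚ-mkℚ : ∀ n → ℕtoℚ n ≡ mkℚ (ℤ.+ n) 0 (Coprime.sym (Coprime.1-coprimeTo n))
ℕtoℚ-mkℚ n = ℚP.normalize-coprime (Coprime.sym (Coprime.1-coprimeTo n))

ℕtoℚ-suc : ∀ n → ℕtoℚ (suc n) ≡ 1ℚ + ℕtoℚ n
ℕtoℚ-suc n = ℚP.toℚᵘ-injective (begin
  ℚ.toℚᵘ (ℕtoℚ (suc n))                    ≡⟨ cong ℚ.toℚᵘ (ℕtoℚ-mkℚ (suc n)) ⟩
  ℚᵘ.mkℚᵘ (ℤ.+ suc n) 0                     ≈⟨ ℚᵘ.*≡* numerators ⟩
  ℚᵘ.mkℚᵘ (ℤ.+ 1) 0 ℚᵘ.+ ℚᵘ.mkℚᵘ (ℤ.+ n) 0  ≡⟨ cong (ℚ.toℚᵘ 1ℚ ℚᵘ.+_) (cong ℚ.toℚᵘ (ℕtoℚ-mkℚ n)) ⟨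
  ℚ.toℚᵘ 1ℚ ℚᵘ.+ ℚ.toℚᵘ (ℕtoℚ n)            ≈⟨ ℚP.toℚᵘ-homo-+ 1ℚ (ℕtoℚ n) ⟨
  ℚ.toℚᵘ (1ℚ + ℕtoℚ n)                      ∎)
  where
  open import Relation.Binary.Reasoning.Setoid ℚᵘP.≃-setoid
  numerators : ℤ.+ suc n ℤ.* ℤ.+ 1 ≡ (ℤ.+ 1 ℤ.* ℤ.+ 1 ℤ.+ ℤ.+ n ℤ.* ℤ.+ 1) ℤ.* ℤ.+ 1
  numerators rewrite ℤP.*-identityʳ (ℤ.+ n) | ℤP.*-identityʳ (ℤ.+ suc n) = refl

ℕtoℚ-+ : ∀ m n → ℕtoℚ (m ℕ.+ n) ≡ ℕtoℚ m + ℕtoℚ n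
ℕtoℚ-+ zero    n = sym (ℚP.+-identityˡ (ℕtoℚ n))
ℕtoℚ-+ (suc m) n = begin
  ℕtoℚ (suc (m ℕ.+ n))     ≡⟨ ℕtoℚ-suc (m ℕ.+ n) ⟩
  1ℚ + ℕtoℚ (m ℕ.+ n)      ≡⟨ cong (1ℚ +_) (ℕtoℚ-+ m n) ⟩
  1ℚ + (ℕtoℚ m + ℕtoℚ n)   ≡⟨ ℚP.+-assoc 1ℚ (ℕtoℚ m) (ℕtoℚ n) ⟨
  (1ℚ + ℕtoℚ m) + ℕtoℚ n   ≡⟨ cong (_+ ℕtoℚ n) (ℕtoℚ-suc m) ⟨
  ℕtoℚ (suc m) + ℕtoℚ n    ∎
  where open ≡-Reasoning

ℕtoℚ-* : ∀ m n → ℕtoℚ (m ℕ.* n) ≡ ℕtoℚ m * ℕtoℚ n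
ℕtoℚ-* zero    n = sym (ℚP.*-zeroˡ (ℕtoℚ n))
ℕtoℚ-* (suc m) n = begin
  ℕtoℚ (n ℕ.+ m ℕ.* n)       ≡⟨ ℕtoℚ-+ n (m ℕ.* n) ⟩
  ℕtoℚ n + ℕtoℚ (m ℕ.* n)    ≡⟨ cong (ℕtoℚ n +_) (ℕtoℚ-* m n) ⟩
  ℕtoℚ n + ℕtoℚ m * ℕtoℚ n   ≡⟨ solve 2 (λ a b → a :+ b :* a := (con 1ℚ :+ b) :* a) refl (ℕtoℚ n) (ℕtoℚ m) ⟩
  (1ℚ + ℕtoℚ m) * ℕtoℚ n     ≡⟨ cong (_* ℕtoℚ n) (ℕtoℚ-suc m) ⟨
  ℕtoℚ (suc m) * ℕtoℚ n      ∎
  where open ≡-Reasoning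

0≤1 : 0ℚ ≤ 1ℚ
0≤1 = ℚP.<⇒≤ (ℚP.positive⁻¹ 1ℚ)

*-monoˡ-≤-0≤ : ∀ {r p q} → 0ℚ ≤ r → p ≤ q → r * p ≤ r * q
*-monoˡ-≤-0≤ {r} 0≤r = ℚP.*-monoˡ-≤-nonNeg r {{ℚ.nonNegative 0≤r}}

*-monoʳ-≤-0≤ : ∀ {r p q} → 0ℚ ≤ r → p ≤ q → p * r ≤ q * r
*-monoʳ-≤-0≤ {r} 0≤r = ℚP.*-monoʳ-≤-nonNeg r {{ℚ.nonNegative 0≤r}}

*-nonNeg : ∀ {p q} → 0ℚ ≤ p → 0ℚ ≤ q → 0ℚ ≤ p * q
*-nonNeg {p} 0≤p 0≤q = ℚP.≤-trans (ℚP.≤-reflexive (sym (ℚP.*-zeroʳ p))) (*-monoˡ-≤-0≤ 0≤p 0≤q)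

0≤ℕtoℚ : ∀ n → 0ℚ ≤ ℕtoℚ n
0≤ℕtoℚ zero    = ℚP.≤-refl
0≤ℕtoℚ (suc n) = ℚP.≤-trans (ℚP.+-mono-≤ 0≤1 (0≤ℕtoℚ n)) (ℚP.≤-reflexive (sym (ℕtoℚ-suc n)))

0<ℕtoℚ-suc : ∀ n → 0ℚ < ℕtoℚ (suc n)
0<ℕtoℚ-suc n = ℚP.<-≤-trans (ℚP.positive⁻¹ 1ℚ) (begin
  1ℚ             ≡⟨ ℚP.+-identityʳ 1ℚ ⟨
  1ℚ + 0ℚ        ≤⟨ ℚP.+-monoʳ-≤ 1ℚ (0≤ℕtoℚ n) ⟩
  1ℚ + ℕtoℚ n    ≡⟨ ℕtoℚ-suc n ⟨
  ℕtoℚ (suc n)   ∎)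
  where open ℚP.≤-Reasoning

ℕtoℚ-mono-≤ : ∀ {m n} → m ℕ.≤ n → ℕtoℚ m ≤ ℕtoℚ n
ℕtoℚ-mono-≤ {m} m≤n with ℕP.m≤n⇒∃[o]m+o≡n m≤n
... | o , refl = begin
  ℕtoℚ m              ≡⟨ ℚP.+-identityʳ (ℕtoℚ m) ⟨
  ℕtoℚ m + 0ℚ         ≤⟨ ℚP.+-monoʳ-≤ (ℕtoℚ m) (0≤ℕtoℚ o) ⟩
  ℕtoℚ m + ℕtoℚ o     ≡⟨ ℕtoℚ-+ m o ⟨
  ℕtoℚ (m ℕ.+ o)      ∎
  where open ℚP.≤-Reasoning

p≤q⇒0≤q-p : ∀ {p q} → p ≤ q → 0ℚ ≤ q - p
p≤q⇒0≤q-p {p} p≤q = ℚP.≤-trans (ℚP.≤-reflexive (sym (ℚP.+-inverseʳ p))) (ℚP.+-monoˡ-≤ (ℚ.- p) p≤q)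

p<q⇒0<q-p : ∀ {p q} → p < q → 0ℚ < q - p
p<q⇒0<q-p {p} p<q = ℚP.≤-<-trans (ℚP.≤-reflexive (sym (ℚP.+-inverseʳ p))) (ℚP.+-monoˡ-< (ℚ.- p) p<q)

0≤q-p⇒p≤q : ∀ {p q} → 0ℚ ≤ q - p → p ≤ q
0≤q-p⇒p≤q {p} {q} 0≤q-p = begin
  p            ≡⟨ ℚP.+-identityʳ p ⟨
  p + 0ℚ       ≤⟨ ℚP.+-monoʳ-≤ p 0≤q-p ⟩
  p + (q - p)  ≡⟨ solve 2 (λ p q → p :+ (q :- p) := q) refl p q ⟩
  q            ∎
  where open ℚP.≤-Reasoning

≤-via-difference : ∀ {p q} r → q - p ≡ r → 0ℚ ≤ r → p ≤ q
≤-via-difference r q-p≡r 0≤r = 0≤q-p⇒p≤q (subst (0ℚ ≤_) (sym q-p≡r) 0≤r)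

<-via-difference : ∀ {p q} r → q - p ≡ r → 0ℚ < r → p < q
<-via-difference {p} {q} r q-p≡r 0<r = begin-strict
  p            ≡⟨ ℚP.+-identityʳ p ⟨
  p + 0ℚ       <⟨ ℚP.+-monoʳ-< p (subst (0ℚ <_) (sym q-p≡r) 0<r) ⟩
  p + (q - p)  ≡⟨ solve 2 (λ p q → p :+ (q :- p) := q) refl p q ⟩
  q            ∎
  where open ℚP.≤-Reasoning

<⇒≱ : ∀ {p q} → p < q → ¬ (q ≤ p)
<⇒≱ p<q q≤p = ℚP.<-irrefl refl (ℚP.<-≤-trans p<q q≤p)

*-≤-via-upper-bound : ∀ {k x b c} → 0ℚ ≤ x → x ≤ b → 0ℚ ≤ c → k * b ≤ c → k * x ≤ c
*-≤-via-upper-bound {k} {x} 0≤x x≤b 0≤c kb≤c with ℚP.≤-total k 0ℚ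
... | inj₁ k≤0 = ℚP.≤-trans (*-monoʳ-≤-0≤ 0≤x k≤0) (ℚP.≤-trans (ℚP.≤-reflexive (ℚP.*-zeroˡ x)) 0≤c)
... | inj₂ 0≤k = ℚP.≤-trans (*-monoˡ-≤-0≤ 0≤k x≤b) kb≤c

archimedean : ∀ q → ∃[ n ] q ≤ ℕtoℚ n
archimedean (mkℚ (ℤ.+ n) den c) = n , subst (mkℚ (ℤ.+ n) den c ≤_) (sym (ℕtoℚ-mkℚ n))
  (ℚ.*≤* (subst₂ ℤ._≤_ (ℤP.pos-* n 1) (ℤP.pos-* n (suc den)) (ℤ.+≤+ (ℕP.*-monoʳ-≤ n (s≤s z≤n)))))
archimedean q@(mkℚ ℤ.-[1+ _ ] _ _) = 0 , ℚP.<⇒≤ (ℚP.negative⁻¹ q)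

archimedean-suc : ∀ {δ} → 0ℚ < δ → ∀ x → ∃[ n ] x ≤ δ * ℕtoℚ (suc n)
archimedean-suc {δ} 0<δ x = k , (begin
  x                      ≡⟨ ℚP.*-identityʳ x ⟨
  x * 1ℚ                 ≡⟨ cong (x *_) (ℚP.*-inverseʳ δ) ⟨
  x * (δ * 1/δ)          ≡⟨ solve 3 (λ x δ i → x :* (δ :* i) := δ :* (x :* i)) refl x δ 1/δ ⟩
  δ * (x * 1/δ)          ≤⟨ *-monoˡ-≤-0≤ (ℚP.<⇒≤ 0<δ) (ℚP.≤-trans x/δ≤k (ℕtoℚ-mono-≤ (ℕP.n≤1+n k))) ⟩
  δ * ℕtoℚ (suc k)       ∎)
  where
  instance
    δ≢0 : ℚ.NonZero δ
    δ≢0 = ℚP.pos⇒nonZero δ {{ℚ.positive 0<δ}}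
  1/δ : ℚ
  1/δ = 1/ δ
  k : ℕ
  k = proj₁ (archimedean (x * 1/δ))
  x/δ≤k : x * 1/δ ≤ ℕtoℚ k
  x/δ≤k = proj₂ (archimedean (x * 1/δ))
  open ℚP.≤-Reasoning

1/suc : ℕ → ℚ
1/suc n = (1/ ℕtoℚ (suc n)) {{ℚP.pos⇒nonZero (ℕtoℚ (suc n)) {{ℚ.positive (0<ℕtoℚ-suc n)}}}}

0<1/suc : ∀ n → 0ℚ < 1/suc n
0<1/suc n = ℚP.positive⁻¹ (1/suc n) {{ℚP.1/pos⇒pos (ℕtoℚ (suc n)) {{ℚ.positive (0<ℕtoℚ-suc n)}}}}

ℕtoℚ-suc*1/suc : ∀ n → ℕtoℚ (suc n) * 1/suc n ≡ 1ℚ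
ℕtoℚ-suc*1/suc n =
  ℚP.*-inverseʳ (ℕtoℚ (suc n)) {{ℚP.pos⇒nonZero (ℕtoℚ (suc n)) {{ℚ.positive (0<ℕtoℚ-suc n)}}}}

*1/suc-≤1 : ∀ {k} n → k ℕ.≤ suc n → ℕtoℚ k * 1/suc n ≤ 1ℚ
*1/suc-≤1 n k≤1+n = ℚP.≤-trans (*-monoʳ-≤-0≤ (ℚP.<⇒≤ (0<1/suc n)) (ℕtoℚ-mono-≤ k≤1+n))
  (ℚP.≤-reflexive (ℕtoℚ-suc*1/suc n))

1/suc-suc<1 : ∀ n → 1/suc (suc n) < 1ℚ
1/suc-suc<1 n = begin-strict
  η          ≡⟨ ℚP.+-identityˡ η ⟨
  0ℚ + η     <⟨ ℚP.+-monoˡ-< η (0<1/suc (suc n)) ⟩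
  η + η      ≡⟨ solve 1 (λ x → x :+ x := con (ℕtoℚ 2) :* x) refl η ⟩
  ℕtoℚ 2 * η ≤⟨ *1/suc-≤1 (suc n) (s≤s (s≤s z≤n)) ⟩
  1ℚ         ∎
  where
  open ℚP.≤-Reasoning
  η : ℚ
  η = 1/suc (suc n)

-- Lists

isYes-true : (a? : Dec A) → A → ⌊ a? ⌋ ≡ true
isYes-true a? a = trans (isYes≗does a?) (dec-true a? a)

isYes-false : (a? : Dec A) → ¬ A → ⌊ a? ⌋ ≡ false
isYes-false a? ¬a = trans (isYes≗does a?) (dec-false a? ¬a)

any-∈ : (p : A → Bool) {x : A} {xs : List A} → x ∈ xs → p x ≡ true → any p xs ≡ true
any-∈ p (here refl) px rewrite px = refl
any-∈ p {xs = y ∷ _} (there x∈xs) px rewrite any-∈ p x∈xs px with p y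
... | true  = refl
... | false = refl

all-universal : (p : A → Bool) (xs : List A) → (∀ x → p x ≡ true) → all p xs ≡ true
all-universal p []       px = refl
all-universal p (x ∷ xs) px rewrite px x | all-universal p xs px = refl

filterB-++ : (p : A → Bool) (xs ys : List A) → filterB p (xs ++ ys) ≡ filterB p xs ++ filterB p ys
filterB-++ p []       ys = refl
filterB-++ p (x ∷ xs) ys with p x
... | true  = cong (x ∷_) (filterB-++ p xs ys)
... | false = filterB-++ p xs ys

filterB-keeps-all : (p : A → Bool) {xs : List A} → All (λ x → p x ≡ true) xs → filterB p xs ≡ xs
filterB-keeps-all p []                 = refl
filterB-keeps-all p {x ∷ _} (px ∷ pxs) rewrite px = cong (x ∷_) (filterB-keeps-all p pxs)

filterB-drops-all : (p : A → Bool) {xs : List A} → All (λ x → p x ≡ false) xs → filterB p xs ≡ []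
filterB-drops-all p []         = refl
filterB-drops-all p (px ∷ pxs) rewrite px = filterB-drops-all p pxs

filterB-concat-replicate : (p : A → Bool) (n : ℕ) (xs : List A) →
  filterB p (concat (replicate n xs)) ≡ concat (replicate n (filterB p xs))
filterB-concat-replicate p zero    xs = refl
filterB-concat-replicate p (suc n) xs =
  trans (filterB-++ p xs _) (cong (filterB p xs ++_) (filterB-concat-replicate p n xs))

All-≡⇒replicate : ∀ {c : A} {xs} → All (_≡ c) xs → xs ≡ replicate (length xs) c
All-≡⇒replicate []           = refl
All-≡⇒replicate (refl ∷ pxs) = cong (_ ∷_) (All-≡⇒replicate pxs)

map-concat-replicate : ∀ {B : Set} (f : A → B) n (xs : List A) →
  map f (concat (replicate n xs)) ≡ concat (replicate n (map f xs))
map-concat-replicate f zero    xs = refl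
map-concat-replicate f (suc n) xs =
  trans (ListP.map-++ f xs _) (cong (map f xs ++_) (map-concat-replicate f n xs))

length-concat-replicate : ∀ n (xs : List A) → length (concat (replicate n xs)) ≡ n ℕ.* length xs
length-concat-replicate zero    xs = refl
length-concat-replicate (suc n) xs =
  trans (ListP.length-++ xs) (cong (length xs ℕ.+_) (length-concat-replicate n xs))

concat-replicate-↭ : ∀ n (x y : A) →
  concat (replicate n (x ∷ y ∷ x ∷ y ∷ [])) ↭ replicate (n ℕ.* 2) x ++ replicate (n ℕ.* 2) y
concat-replicate-↭ zero    x y = ↭-refl
concat-replicate-↭ (suc n) x y =
  ↭-trans (prep x (prep y (prep x (prep y (concat-replicate-↭ n x y)))))
  (↭-trans (prep x (swap y x ↭-refl))
  (prep x (prep x (PermP.shifts (y ∷ y ∷ []) (replicate (n ℕ.* 2) x)))))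

-- Vectors

lookup-addV : (u v : Vec ℚ n) (i : Fin n) → lookup (addV u v) i ≡ lookup u i + lookup v i
lookup-addV u v i = VecP.lookup-zipWith _+_ i u v

lookup-zeroV : (i : Fin n) → lookup (zeroV {n}) i ≡ 0ℚ
lookup-zeroV i = VecP.lookup-replicate i 0ℚ

lookup-sumV : (vs : List (Vec ℚ n)) (i : Fin n) → lookup (sumV vs) i ≡ sumℚ (map (λ v → lookup v i) vs)
lookup-sumV []       i = lookup-zeroV i
lookup-sumV (v ∷ vs) i = trans (lookup-addV v (sumV vs) i) (cong (lookup v i +_) (lookup-sumV vs i))

addV-identityˡ : (v : Vec ℚ n) → addV zeroV v ≡ v
addV-identityˡ Vec.[]       = refl
addV-identityˡ (x Vec.∷ v) = cong₂ Vec._∷_ (ℚP.+-identityˡ x) (addV-identityˡ v)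

addV-identityʳ : (v : Vec ℚ n) → addV v zeroV ≡ v
addV-identityʳ Vec.[]       = refl
addV-identityʳ (x Vec.∷ v) = cong₂ Vec._∷_ (ℚP.+-identityʳ x) (addV-identityʳ v)

addV-assoc : (u v w : Vec ℚ n) → addV (addV u v) w ≡ addV u (addV v w)
addV-assoc Vec.[]       Vec.[]       Vec.[]       = refl
addV-assoc (x Vec.∷ u) (y Vec.∷ v) (z Vec.∷ w) = cong₂ Vec._∷_ (ℚP.+-assoc x y z) (addV-assoc u v w)

lookup-sumV-replicate : ∀ k (v : Vec ℚ n) i → lookup (sumV (replicate k v)) i ≡ ℕtoℚ k * lookup v i
lookup-sumV-replicate zero    v i = trans (lookup-zeroV i) (sym (ℚP.*-zeroˡ (lookup v i)))
lookup-sumV-replicate (suc k) v i = begin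
  lookup (addV v (sumV (replicate k v))) i   ≡⟨ lookup-addV v (sumV (replicate k v)) i ⟩
  lookup v i + lookup (sumV (replicate k v)) i ≡⟨ cong (lookup v i +_) (lookup-sumV-replicate k v i) ⟩
  lookup v i + ℕtoℚ k * lookup v i          ≡⟨ solve 2 (λ x n → x :+ n :* x := (con 1ℚ :+ n) :* x) refl (lookup v i) (ℕtoℚ k) ⟩
  (1ℚ + ℕtoℚ k) * lookup v i                ≡⟨ cong (_* lookup v i) (ℕtoℚ-suc k) ⟨
  ℕtoℚ (suc k) * lookup v i                 ∎
  where open ≡-Reasoning

lookup-sumV-≤ : (vs : List (Vec ℚ n)) (β : ℚ) (i : Fin n) → All (λ v → lookup v i ≤ β) vs →
  lookup (sumV vs) i ≤ ℕtoℚ (length vs) * β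
lookup-sumV-≤ []       β i []         = ℚP.≤-reflexive (trans (lookup-zeroV i) (sym (ℚP.*-zeroˡ β)))
lookup-sumV-≤ (v ∷ vs) β i (v≤ ∷ vs≤) = begin
  lookup (addV v (sumV vs)) i              ≡⟨ lookup-addV v (sumV vs) i ⟩
  lookup v i + lookup (sumV vs) i          ≤⟨ ℚP.+-mono-≤ v≤ (lookup-sumV-≤ vs β i vs≤) ⟩
  β + ℕtoℚ (length vs) * β                 ≡⟨ solve 2 (λ b n → b :+ n :* b := (con 1ℚ :+ n) :* b) refl β (ℕtoℚ (length vs)) ⟩
  (1ℚ + ℕtoℚ (length vs)) * β              ≡⟨ cong (_* β) (ℕtoℚ-suc (length vs)) ⟨
  ℕtoℚ (suc (length vs)) * β               ∎
  where open ℚP.≤-Reasoning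

leOne-true : (v : Vec ℚ n) → (∀ i → lookup v i ≤ 1ℚ) → leOne v ≡ true
leOne-true Vec.[]       v≤1 = refl
leOne-true (x Vec.∷ v) v≤1
  rewrite isYes-true (x ℚP.≤? 1ℚ) (v≤1 Fin.zero) | leOne-true v (λ i → v≤1 (Fin.suc i)) = refl

leOne-false : (v : Vec ℚ n) (i : Fin n) → 1ℚ < lookup v i → leOne v ≡ false
leOne-false (x Vec.∷ v) Fin.zero    1<x rewrite isYes-false (x ℚP.≤? 1ℚ) (<⇒≱ 1<x) = refl
leOne-false (x Vec.∷ v) (Fin.suc i) 1<v rewrite leOne-false v i 1<v = ∧-zeroʳ _

spike : Fin n → ℚ → ℚ → Vec ℚ n
spike c x y = Vec.tabulate (λ i → if ⌊ c Fin.≟ i ⌋ then x else y)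

lookup-spike-≡ : (c : Fin n) (x y : ℚ) → lookup (spike c x y) c ≡ x
lookup-spike-≡ c x y rewrite VecP.lookup∘tabulate (λ i → if ⌊ c Fin.≟ i ⌋ then x else y) c
  | isYes-true (c Fin.≟ c) refl = refl

lookup-spike-≢ : (c i : Fin n) (x y : ℚ) → ¬ c ≡ i → lookup (spike c x y) i ≡ y
lookup-spike-≢ c i x y c≢i rewrite VecP.lookup∘tabulate (λ i → if ⌊ c Fin.≟ i ⌋ then x else y) i
  | isYes-false (c Fin.≟ i) c≢i = refl

spike-cases : ∀ {P : ℚ → Set} (c i : Fin n) (x y : ℚ) → (c ≡ i → P x) → (¬ c ≡ i → P y) → P (lookup (spike c x y) i)
spike-cases {P = P} c i x y on off with c Fin.≟ i
... | yes refl = subst P (sym (lookup-spike-≡ c x y)) (on refl)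
... | no  c≢i  = subst P (sym (lookup-spike-≢ c i x y c≢i)) (off c≢i)

sum-tabulate-zeros : (f : Fin n → ℚ) → (∀ c → f c ≡ 0ℚ) → sumℚ (tabulate f) ≡ 0ℚ
sum-tabulate-zeros {zero}  f f≡0 = refl
sum-tabulate-zeros {suc n} f f≡0 =
  trans (cong₂ _+_ (f≡0 Fin.zero) (sum-tabulate-zeros (λ c → f (Fin.suc c)) (λ c → f≡0 (Fin.suc c)))) (ℚP.+-identityˡ 0ℚ)

sum-tabulate-delta : (f : Fin n → ℚ) (i : Fin n) {x : ℚ} → f i ≡ x → (∀ c → ¬ c ≡ i → f c ≡ 0ℚ) →
  sumℚ (tabulate f) ≡ x
sum-tabulate-delta f Fin.zero    fi≡x f≡0 = trans (cong₂ _+_ fi≡x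
  (sum-tabulate-zeros (λ c → f (Fin.suc c)) (λ c → f≡0 (Fin.suc c) (λ ())))) (ℚP.+-identityʳ _)
sum-tabulate-delta f (Fin.suc i) fi≡x f≡0 = trans (cong₂ _+_ (f≡0 Fin.zero (λ ()))
  (sum-tabulate-delta (λ c → f (Fin.suc c)) i fi≡x (λ c c≢i → f≡0 (Fin.suc c) (λ { refl → c≢i refl })))) (ℚP.+-identityˡ _)

sum-spikes : ∀ d (i : Fin d) x → lookup (sumV (map (λ c → spike c x 0ℚ) (allFin d))) i ≡ x
sum-spikes d i x = begin
  lookup (sumV (map (λ c → spike c x 0ℚ) (allFin d))) i
    ≡⟨ lookup-sumV (map (λ c → spike c x 0ℚ) (allFin d)) i ⟩
  sumℚ (map (λ v → lookup v i) (map (λ c → spike c x 0ℚ) (allFin d)))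
    ≡⟨ cong sumℚ (ListP.map-∘ (allFin d)) ⟨
  sumℚ (map coordinate (allFin d))
    ≡⟨ cong sumℚ (ListP.map-tabulate (λ c → c) coordinate) ⟩
  sumℚ (tabulate coordinate)
    ≡⟨ sum-tabulate-delta coordinate i (lookup-spike-≡ i x 0ℚ) (λ c c≢i → lookup-spike-≢ c i x 0ℚ c≢i) ⟩
  x ∎
  where
  open ≡-Reasoning
  coordinate : Fin d → ℚ
  coordinate c = lookup (spike c x 0ℚ) i

-- Event times, spans and OPT

activeAt-true : ∀ {d} t (r : Item d) → arr r ≤ t → t < dep r → activeAt t r ≡ true
activeAt-true t r a≤t t<e
  rewrite isYes-true (arr r ℚP.≤? t) a≤t | isYes-true (t ℚP.<? dep r) t<e = refl

activeAt-before : ∀ {d} t (r : Item d) → t < arr r → activeAt t r ≡ false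
activeAt-before t r t<a rewrite isYes-false (arr r ℚP.≤? t) (<⇒≱ t<a) = refl

activeAt-after : ∀ {d} t (r : Item d) → dep r ≤ t → activeAt t r ≡ false
activeAt-after t r e≤t rewrite isYes-false (t ℚP.<? dep r) (λ t<e → <⇒≱ t<e e≤t) =
  ∧-zeroʳ ⌊ arr r ℚP.≤? t ⌋

-- A run (k , x) stands for k + 1 consecutive copies of x.
expand : List (ℕ × ℚ) → List ℚ
expand = concatMap (λ (k , x) → replicate (suc k) x)

module _ (f : ℚ → ℚ → ℚ) (f-diag : ∀ x → f x x ≡ 0ℚ) where

  sumSegs-stutter : ∀ x k ys → sumSegs f (x ∷ replicate k x ++ ys) ≡ sumSegs f (x ∷ ys)
  sumSegs-stutter x zero    ys = refl
  sumSegs-stutter x (suc k) ys rewrite f-diag x =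
    trans (ℚP.+-identityˡ _) (sumSegs-stutter x k ys)

  sumSegs-expand-cons : ∀ x rs → sumSegs f (x ∷ expand rs) ≡ sumSegs f (x ∷ map proj₂ rs)
  sumSegs-expand-cons x []             = refl
  sumSegs-expand-cons x ((k , y) ∷ rs) = cong (f x y +_) (begin
    sumSegs f (y ∷ replicate k y ++ expand rs)  ≡⟨ sumSegs-stutter y k (expand rs) ⟩
    sumSegs f (y ∷ expand rs)                   ≡⟨ sumSegs-expand-cons y rs ⟩
    sumSegs f (y ∷ map proj₂ rs)                ∎)
    where open ≡-Reasoning

  sumSegs-expand : ∀ rs → sumSegs f (expand rs) ≡ sumSegs f (map proj₂ rs)
  sumSegs-expand []             = refl
  sumSegs-expand ((k , x) ∷ rs) =
    trans (sumSegs-stutter x k (expand rs)) (sumSegs-expand-cons x rs)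

sumSegs-nonNeg : ∀ (f : ℚ → ℚ → ℚ) → (∀ {p q} → p ≤ q → 0ℚ ≤ f p q) →
  ∀ {xs} → Linked _≤_ xs → 0ℚ ≤ sumSegs f xs
sumSegs-nonNeg f f≥0 []             = ℚP.≤-refl
sumSegs-nonNeg f f≥0 [-]            = ℚP.≤-refl
sumSegs-nonNeg f f≥0 (p≤q ∷ sorted) = ℚP.+-mono-≤ (f≥0 p≤q) (sumSegs-nonNeg f f≥0 sorted)

linked-stutter : ∀ x k {ys} → Linked _≤_ (x ∷ ys) → Linked _≤_ (x ∷ replicate k x ++ ys)
linked-stutter x zero    sorted = sorted
linked-stutter x (suc k) sorted = ℚP.≤-refl ∷ linked-stutter x k sorted

linked-expand-cons : ∀ x rs → Linked _≤_ (x ∷ map proj₂ rs) → Linked _≤_ (x ∷ expand rs)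
linked-expand-cons x []             _              = [-]
linked-expand-cons x ((k , y) ∷ rs) (x≤y ∷ sorted) =
  x≤y ∷ linked-stutter y k (linked-expand-cons y rs sorted)

linked-expand : ∀ rs → Linked _≤_ (map proj₂ rs) → Linked _≤_ (expand rs)
linked-expand []             _      = []
linked-expand ((k , x) ∷ rs) sorted =
  linked-stutter x k (linked-expand-cons x rs sorted)

module Sort = MergeSortP ℚP.≤-decTotalOrder

endpoints : ∀ {d} → Instance d → List ℚ
endpoints R = concatMap (λ r → arr r ∷ dep r ∷ []) R

endpoints-↭ : ∀ {d} (R : Instance d) → endpoints R ↭ map arr R ++ map dep R
endpoints-↭ []      = ↭-refl
endpoints-↭ (r ∷ R) = prep (arr r) (↭-trans (prep (dep r) (endpoints-↭ R))
  (↭-sym (PermP.shift (dep r) (map arr R) (map dep R))))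

eventTimes-sorted : ∀ {d} (R : Instance d) → Linked _≤_ (eventTimes R)
eventTimes-sorted R = Sort.sort-↗ (endpoints R)

eventTimes-unique : ∀ {d} (R : Instance d) {ys} → Linked _≤_ ys → ys ↭ map arr R ++ map dep R →
  eventTimes R ≡ ys
eventTimes-unique R ys-sorted ys↭ = Pointwise.Pointwise-≡⇒≡
  (SortedP.↗↭↗⇒≋ (DecTotalOrder.totalOrder ℚP.≤-decTotalOrder) (eventTimes-sorted R) ys-sorted
    (↭⇒↭ₛ (↭-trans (Sort.sort-↭ (endpoints R)) (↭-trans (endpoints-↭ R) (↭-sym ys↭)))))

eventTimes-expand : ∀ {d} (R : Instance d) rs → Linked _≤_ (map proj₂ rs) →
  expand rs ↭ map arr R ++ map dep R → eventTimes R ≡ expand rs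
eventTimes-expand R rs sorted = eventTimes-unique R (linked-expand rs sorted)

spanSeg : ∀ {d} → List (Item d) → ℚ → ℚ → ℚ
spanSeg S p q = if any (activeAt p) S then q - p else 0ℚ

spanSeg-diag : ∀ {d} (S : List (Item d)) → ∀ x → spanSeg S x x ≡ 0ℚ
spanSeg-diag S x with any (activeAt x) S
... | true  = ℚP.+-inverseʳ x
... | false = refl

span-expand : ∀ {d} (S : List (Item d)) (rs : List (ℕ × ℚ)) → Linked _≤_ (map proj₂ rs) →
  expand rs ↭ map arr S ++ map dep S → span S ≡ sumSegs (spanSeg S) (map proj₂ rs)
span-expand S rs sorted rs↭ = trans (cong (sumSegs (spanSeg S)) (eventTimes-expand S rs sorted rs↭))
  (sumSegs-expand (spanSeg S) (spanSeg-diag S) rs)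

optSeg : ∀ {d} → Instance d → ℚ → ℚ → ℚ
optSeg R p q = (q - p) * ℕtoℚ (optAt R p)

optSeg-diag : ∀ {d} (R : Instance d) → ∀ x → optSeg R x x ≡ 0ℚ
optSeg-diag R x = trans (cong (_* ℕtoℚ (optAt R x)) (ℚP.+-inverseʳ x)) (ℚP.*-zeroˡ (ℕtoℚ (optAt R x)))

OPT-nonNeg : ∀ {d} (R : Instance d) → 0ℚ ≤ OPT R
OPT-nonNeg R = sumSegs-nonNeg (optSeg R) (λ {p} p≤q → *-nonNeg (p≤q⇒0≤q-p p≤q) (0≤ℕtoℚ (optAt R p)))
  (eventTimes-sorted R)

OPT-expand : ∀ {d} (R : Instance d) (rs : List (ℕ × ℚ)) → Linked _≤_ (map proj₂ rs) →
  expand rs ↭ map arr R ++ map dep R → OPT R ≡ sumSegs (optSeg R) (map proj₂ rs)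
OPT-expand R rs sorted rs↭ = trans (cong (sumSegs (optSeg R)) (eventTimes-expand R rs sorted rs↭))
  (sumSegs-expand (optSeg R) (optSeg-diag R) rs)

-- Move To Front

load : ∀ {d} → ℚ → Bin d → Fin d → ℚ
load t b i = sumℚ (map (λ r → lookup (size r) i) (filterB (activeAt t) b))

loadWith : ∀ {d} → Item d → Bin d → Vec ℚ d
loadWith r b = addV (sumV (map size (filterB (activeAt (arr r)) b))) (size r)

lookup-loadWith : ∀ {d} (r : Item d) (b : Bin d) (i : Fin d) →
  lookup (loadWith r b) i ≡ load (arr r) b i + lookup (size r) i
lookup-loadWith {d} r b i = begin
  lookup (addV (sumV (map size active)) (size r)) i
    ≡⟨ lookup-addV (sumV (map size active)) (size r) i ⟩
  lookup (sumV (map size active)) i + lookup (size r) i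
    ≡⟨ cong (_+ lookup (size r) i) (lookup-sumV (map size active) i) ⟩
  sumℚ (map (λ v → lookup v i) (map size active)) + lookup (size r) i
    ≡⟨ cong (λ xs → sumℚ xs + lookup (size r) i) (ListP.map-∘ active) ⟨
  load (arr r) b i + lookup (size r) i ∎
  where
  open ≡-Reasoning
  active : List (Item d)
  active = filterB (activeAt (arr r)) b

canAccept-true : ∀ {d} (r : Item d) (b : Bin d) → binOpenAt (arr r) b ≡ true →
  (∀ i → load (arr r) b i + lookup (size r) i ≤ 1ℚ) → canAccept r b ≡ true
canAccept-true r b open-b fits rewrite open-b =
  leOne-true (loadWith r b) (λ i → ℚP.≤-trans (ℚP.≤-reflexive (lookup-loadWith r b i)) (fits i))

canAccept-false : ∀ {d} (r : Item d) (b : Bin d) (i : Fin d) →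
  1ℚ < load (arr r) b i + lookup (size r) i → canAccept r b ≡ false
canAccept-false r b i overflow = trans
  (cong (binOpenAt (arr r) b ∧_) (leOne-false (loadWith r b) i
    (ℚP.<-≤-trans overflow (ℚP.≤-reflexive (sym (lookup-loadWith r b i))))))
  (∧-zeroʳ (binOpenAt (arr r) b))

Rejects : ∀ {d} → Item d → List (Bin d) → Set
Rejects r = All (λ b → canAccept r b ≡ false)

place-rejected : ∀ {d} (r : Item d) {bins : List (Bin d)} → Rejects r bins → place r bins ≡ nothing
place-rejected r []           = refl
place-rejected r (rej ∷ rejs) rewrite rej | place-rejected r rejs = refl

place-first-fit : ∀ {d} (r : Item d) {pre : List (Bin d)} (b : Bin d) (post : List (Bin d)) →
  Rejects r pre → canAccept r b ≡ true → place r (pre ++ b ∷ post) ≡ just (r ∷ b , pre ++ post)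
place-first-fit r b post []           fits rewrite fits = refl
place-first-fit r b post (rej ∷ rejs) fits rewrite rej | place-first-fit r b post rejs fits = refl

mfInsert-new-bin : ∀ {d} (r : Item d) {bins : List (Bin d)} → Rejects r bins → mfInsert r bins ≡ (r ∷ []) ∷ bins
mfInsert-new-bin r rejs rewrite place-rejected r rejs = refl

mfInsert-first-fit : ∀ {d} (r : Item d) {pre : List (Bin d)} (b : Bin d) (post : List (Bin d)) →
  Rejects r pre → canAccept r b ≡ true → mfInsert r (pre ++ b ∷ post) ≡ (r ∷ b) ∷ pre ++ post
mfInsert-first-fit r b post rejs fits rewrite place-first-fit r b post rejs fits = refl

runFrom : ∀ {d} → List (Bin d) → Instance d → List (Bin d)
runFrom = foldl (λ bins r → mfInsert r bins)

runFrom-++ : ∀ {d} (bins : List (Bin d)) (R R′ : Instance d) → runFrom bins (R ++ R′) ≡ runFrom (runFrom bins R) R′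
runFrom-++ = ListP.foldl-++ (λ bins r → mfInsert r bins)

costMF-uniform : ∀ {d} (R : Instance d) (x : ℚ) → All (λ b → span b ≡ x) (runMF R) →
  costMF R ≡ ℕtoℚ (length (runMF R)) * x
costMF-uniform R x = sum-spans (runMF R)
  where
  sum-spans : ∀ bins → All (λ b → span b ≡ x) bins → sumℚ (map span bins) ≡ ℕtoℚ (length bins) * x
  sum-spans []         []              = sym (ℚP.*-zeroˡ x)
  sum-spans (b ∷ bins) (span≡ ∷ spans≡) = begin
    span b + sumℚ (map span bins)   ≡⟨ cong₂ _+_ span≡ (sum-spans bins spans≡) ⟩
    x + ℕtoℚ (length bins) * x      ≡⟨ solve 2 (λ x n → x :+ n :* x := (con 1ℚ :+ n) :* x) refl x (ℕtoℚ (length bins)) ⟩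
    (1ℚ + ℕtoℚ (length bins)) * x   ≡⟨ cong (_* x) (ℕtoℚ-suc (length bins)) ⟨
    ℕtoℚ (suc (length bins)) * x    ∎
    where open ≡-Reasoning

module PairPhase {d : ℕ} {X : Set} (big small : X → Item d)
  (big-rejected : ∀ c c′ → canAccept (big c) (small c′ ∷ big c′ ∷ []) ≡ false)
  (small-accepted : ∀ c → canAccept (small c) (big c ∷ []) ≡ true) where

  IsPairBin : Bin d → Set
  IsPairBin b = ∃[ c ] b ≡ small c ∷ big c ∷ []

  pairs : List X → Instance d
  pairs = concatMap (λ c → big c ∷ small c ∷ [])

  All-pairs : {P : Item d → Set} → (∀ c → P (big c)) → (∀ c → P (small c)) → ∀ cs → All P (pairs cs)
  All-pairs P-big P-small []       = []
  All-pairs P-big P-small (c ∷ cs) = P-big c ∷ P-small c ∷ All-pairs P-big P-small cs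

  map-size-pairs : ∀ cs → map size (pairs cs) ≡ concatMap (λ c → size (big c) ∷ size (small c) ∷ []) cs
  map-size-pairs []       = refl
  map-size-pairs (c ∷ cs) = cong (λ vs → size (big c) ∷ size (small c) ∷ vs) (map-size-pairs cs)

  big-rejected-by : ∀ c {bins} → All IsPairBin bins → Rejects (big c) bins
  big-rejected-by c []                 = []
  big-rejected-by c ((c′ , refl) ∷ ps) = big-rejected c c′ ∷ big-rejected-by c ps

  runFrom-pair : ∀ c {bins} → All IsPairBin bins →
    runFrom bins (big c ∷ small c ∷ []) ≡ (small c ∷ big c ∷ []) ∷ bins
  runFrom-pair c {bins} ps rewrite mfInsert-new-bin (big c) (big-rejected-by c ps) =
    mfInsert-first-fit (small c) {[]} (big c ∷ []) bins [] (small-accepted c)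

  runFrom-pairs : ∀ cs {bins} → All IsPairBin bins →
    All IsPairBin (runFrom bins (pairs cs)) × length (runFrom bins (pairs cs)) ≡ length cs ℕ.+ length bins
  runFrom-pairs []       ps = ps , refl
  runFrom-pairs (c ∷ cs) {bins} ps
    rewrite runFrom-++ bins (big c ∷ small c ∷ []) (pairs cs) | runFrom-pair c ps
    with runFrom-pairs cs ((c , refl) ∷ ps)
  ... | ps′ , len = ps′ , trans len (ℕP.+-suc (length cs) (length bins))

  runFrom-blocks : ∀ m cs {bins} → All IsPairBin bins →
    All IsPairBin (runFrom bins (concat (replicate m (pairs cs))))
    × length (runFrom bins (concat (replicate m (pairs cs)))) ≡ m ℕ.* length cs ℕ.+ length bins
  runFrom-blocks zero    cs ps = ps , refl
  runFrom-blocks (suc m) cs {bins} ps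
    rewrite runFrom-++ bins (pairs cs) (concat (replicate m (pairs cs)))
    with runFrom-pairs cs ps
  ... | ps₁ , len₁ with runFrom-blocks m cs ps₁
  ... | ps₂ , len₂ = ps₂ , (begin
    length (runFrom (runFrom bins (pairs cs)) (concat (replicate m (pairs cs)))) ≡⟨ len₂ ⟩
    m ℕ.* l ℕ.+ length (runFrom bins (pairs cs)) ≡⟨ cong (m ℕ.* l ℕ.+_) len₁ ⟩
    m ℕ.* l ℕ.+ (l ℕ.+ length bins)        ≡⟨ ℕP.+-assoc (m ℕ.* l) l (length bins) ⟨
    m ℕ.* l ℕ.+ l ℕ.+ length bins          ≡⟨ cong (ℕ._+ length bins) (ℕP.+-comm (m ℕ.* l) l) ⟩
    suc m ℕ.* l ℕ.+ length bins            ∎)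
    where
    open ≡-Reasoning
    l : ℕ
    l = length cs

module TailPhase {d : ℕ} (r : Item d) (Open Full : Bin d → Set)
  (accepts : ∀ {b} → Open b → canAccept r b ≡ true)
  (rejects : ∀ {b} → Full b → canAccept r b ≡ false)
  (fills : ∀ {b} → Open b → Full (r ∷ b)) where

  rejected-by : ∀ {bins} → All Full bins → Rejects r bins
  rejected-by []             = []
  rejected-by (full ∷ fulls) = rejects full ∷ rejected-by fulls

  -- A served bin moves to the front but is Full, so the next copy of r skips it and every bin
  -- already served, and lands in the next Open bin.
  runFrom-tail : ∀ {pre} post → All Full pre → All Open post →
    All Full (runFrom (pre ++ post) (replicate (length post) r))
    × length (runFrom (pre ++ post) (replicate (length post) r)) ≡ length pre ℕ.+ length post
  runFrom-tail {pre} []         fulls [] = AllP.++⁺ fulls [] , ListP.length-++ pre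
  runFrom-tail {pre} (b ∷ post) fulls (open-b ∷ opens)
    rewrite mfInsert-first-fit r b post (rejected-by fulls) (accepts open-b)
    with runFrom-tail post (fills open-b ∷ fulls) opens
  ... | fulls′ , len = fulls′ , trans len (sym (ℕP.+-suc (length pre) (length post)))

-- Explicit packings

search-≤ : (P : ℕ → Bool) (S : ℕ → ℕ → ℕ) →
  (∀ k → S k 0 ≡ k) → (∀ k n → S k (suc n) ≡ (if P k then k else S (suc k) n)) →
  ∀ {m} → P m ≡ true → ∀ k n → k ℕ.≤ m → S k n ℕ.≤ m
search-≤ P S S-zero S-suc Pm k zero    k≤m rewrite S-zero k = k≤m
search-≤ P S S-zero S-suc {m} Pm k (suc n) k≤m rewrite S-suc k n with P k in Pk
... | true  = k≤m
... | false with ℕP.m≤n⇒m<n∨m≡n k≤m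
...   | inj₁ k<m  = search-≤ P S S-zero S-suc Pm (suc k) n k<m
...   | inj₂ refl with () ← trans (sym Pk) Pm

-- optBins runs a local search loop that cannot be named; optBins-≤ generalises the loop's start
-- and fuel so that search-≤ applies to it. The hypothesis is boxed in a record because that
-- generalisation would otherwise also act inside the normal form of packable m vs.
record Packable {d} (m : ℕ) (vs : List (Vec ℚ d)) : Set where
  constructor box
  field unbox : packable m vs ≡ true

optBins-≤ : ∀ {d} (vs : List (Vec ℚ d)) m → Packable m vs → optBins vs ℕ.≤ m
optBins-≤ vs m packable-m
  with search-≤ (λ k → packable k vs) _ (λ _ → refl) (λ _ _ → refl) (Packable.unbox packable-m)
... | bound with 0 | z≤n {m} | length vs
...   | k | k≤m | n = bound k n k≤m

∈-assignments : ∀ m (as : List (Fin m)) → as ∈ assignments m (length as)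
∈-assignments m []       = here refl
∈-assignments m (a ∷ as) = MemP.∈-concat⁺′ (MemP.∈-map⁺ (a ∷_) (∈-assignments m as))
  (MemP.∈-map⁺ (λ j → map (j ∷_) (assignments m (length as))) (MemP.∈-allFin a))

packable-by : ∀ {d m} (vs : List (Vec ℚ d)) (as : List (Fin m)) → length as ≡ length vs →
  (∀ j → leOne (loadOf j as vs) ≡ true) → Packable m vs
packable-by {m = m} vs as len fits = box (subst (λ n → any fitting (assignments m n) ≡ true) len
  (any-∈ fitting (∈-assignments m as) (all-universal _ (allFin m) fits)))
  where
  fitting : List (Fin m) → Bool
  fitting asg = all (λ j → leOne (loadOf j asg vs)) (allFin m)

suc-≟-suc : (a j : Fin m) → ⌊ Fin.suc a Fin.≟ Fin.suc j ⌋ ≡ ⌊ a Fin.≟ j ⌋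
suc-≟-suc a j = trans (isYes≗does (Fin.suc a Fin.≟ Fin.suc j)) (sym (isYes≗does (a Fin.≟ j)))

loadOf-++ : (j : Fin m) (as as′ : List (Fin m)) (vs vs′ : List (Vec ℚ n)) → length as ≡ length vs →
  loadOf j (as ++ as′) (vs ++ vs′) ≡ addV (loadOf j as vs) (loadOf j as′ vs′)
loadOf-++ j []       as′ []       vs′ _   = sym (addV-identityˡ (loadOf j as′ vs′))
loadOf-++ j (a ∷ as) as′ (v ∷ vs) vs′ len with ⌊ a Fin.≟ j ⌋
... | true  = trans (cong (addV v) (loadOf-++ j as as′ vs vs′ (ℕP.suc-injective len))) (sym (addV-assoc v _ _))
... | false = loadOf-++ j as as′ vs vs′ (ℕP.suc-injective len)

loadOf-suc-map-suc : (j : Fin m) (as : List (Fin m)) (vs : List (Vec ℚ n)) →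
  loadOf (Fin.suc j) (map Fin.suc as) vs ≡ loadOf j as vs
loadOf-suc-map-suc j []       []       = refl
loadOf-suc-map-suc j []       (v ∷ vs) = refl
loadOf-suc-map-suc j (a ∷ as) []       = refl
loadOf-suc-map-suc j (a ∷ as) (v ∷ vs) rewrite suc-≟-suc a j with ⌊ a Fin.≟ j ⌋
... | true  = cong (addV v) (loadOf-suc-map-suc j as vs)
... | false = loadOf-suc-map-suc j as vs

loadOf-zero-map-suc : (as : List (Fin m)) (vs : List (Vec ℚ n)) → loadOf Fin.zero (map Fin.suc as) vs ≡ zeroV
loadOf-zero-map-suc []       []       = refl
loadOf-zero-map-suc []       (v ∷ vs) = refl
loadOf-zero-map-suc (a ∷ as) []       = refl
loadOf-zero-map-suc (a ∷ as) (v ∷ vs) = loadOf-zero-map-suc as vs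

loadOf-replicate-≡ : (ℓ j : Fin m) → ⌊ ℓ Fin.≟ j ⌋ ≡ true → (vs : List (Vec ℚ n)) →
  loadOf j (replicate (length vs) ℓ) vs ≡ sumV vs
loadOf-replicate-≡ ℓ j ℓ≡j []       = refl
loadOf-replicate-≡ ℓ j ℓ≡j (v ∷ vs) rewrite ℓ≡j = cong (addV v) (loadOf-replicate-≡ ℓ j ℓ≡j vs)

loadOf-replicate-≢ : (ℓ j : Fin m) → ⌊ ℓ Fin.≟ j ⌋ ≡ false → (vs : List (Vec ℚ n)) →
  loadOf j (replicate (length vs) ℓ) vs ≡ zeroV
loadOf-replicate-≢ ℓ j ℓ≢j []       = refl
loadOf-replicate-≢ ℓ j ℓ≢j (v ∷ vs) rewrite ℓ≢j = loadOf-replicate-≢ ℓ j ℓ≢j vs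

fromℕ-or-inject₁ : ∀ n (j : Fin (suc n)) → j ≡ Fin.fromℕ n ⊎ ∃[ j′ ] j ≡ Fin.inject₁ j′
fromℕ-or-inject₁ zero    Fin.zero    = inj₁ refl
fromℕ-or-inject₁ (suc n) Fin.zero    = inj₂ (Fin.zero , refl)
fromℕ-or-inject₁ (suc n) (Fin.suc j) with fromℕ-or-inject₁ n j
... | inj₁ refl        = inj₁ refl
... | inj₂ (j′ , refl) = inj₂ (Fin.suc j′ , refl)

module BlockPacking {d : ℕ} {X : Set} (u w : X → Vec ℚ d) (cs : List X) where

  block : List (Vec ℚ d)
  block = concatMap (λ c → u c ∷ w c ∷ []) cs

  U W : Vec ℚ d
  U = sumV (map u cs)
  W = sumV (map w cs)

  blockBins : Fin m → Fin m → List (Fin m)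
  blockBins g ℓ = concatMap (λ _ → g ∷ ℓ ∷ []) cs

  module _ (g ℓ j : Fin m) where

    length-blockBins : length (blockBins g ℓ) ≡ length block
    length-blockBins = go cs
      where
      go : ∀ cs → length (concatMap (λ _ → g ∷ ℓ ∷ []) cs) ≡ length (concatMap (λ c → u c ∷ w c ∷ []) cs)
      go []       = refl
      go (c ∷ cs) = cong (λ n → suc (suc n)) (go cs)

    loadOf-blockBins-u : ⌊ g Fin.≟ j ⌋ ≡ true → ⌊ ℓ Fin.≟ j ⌋ ≡ false → loadOf j (blockBins g ℓ) block ≡ U
    loadOf-blockBins-u g≡j ℓ≢j = go cs
      where
      go : ∀ cs → loadOf j (concatMap (λ _ → g ∷ ℓ ∷ []) cs) (concatMap (λ c → u c ∷ w c ∷ []) cs) ≡ sumV (map u cs)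
      go []       = refl
      go (c ∷ cs) rewrite g≡j | ℓ≢j = cong (addV (u c)) (go cs)

    loadOf-blockBins-w : ⌊ g Fin.≟ j ⌋ ≡ false → ⌊ ℓ Fin.≟ j ⌋ ≡ true → loadOf j (blockBins g ℓ) block ≡ W
    loadOf-blockBins-w g≢j ℓ≡j = go cs
      where
      go : ∀ cs → loadOf j (concatMap (λ _ → g ∷ ℓ ∷ []) cs) (concatMap (λ c → u c ∷ w c ∷ []) cs) ≡ sumV (map w cs)
      go []       = refl
      go (c ∷ cs) rewrite g≢j | ℓ≡j = cong (addV (w c)) (go cs)

    loadOf-blockBins-none : ⌊ g Fin.≟ j ⌋ ≡ false → ⌊ ℓ Fin.≟ j ⌋ ≡ false → loadOf j (blockBins g ℓ) block ≡ zeroV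
    loadOf-blockBins-none g≢j ℓ≢j = go cs
      where
      go : ∀ cs → loadOf j (concatMap (λ _ → g ∷ ℓ ∷ []) cs) (concatMap (λ c → u c ∷ w c ∷ []) cs) ≡ zeroV
      go []       = refl
      go (c ∷ cs) rewrite g≢j | ℓ≢j = go cs

  blocks : ℕ → List (Vec ℚ d)
  blocks n = concat (replicate n block)

  -- Block k goes to bin k; every w-vector goes to the last bin.
  assignment : (n : ℕ) → List (Fin (suc n))
  assignment zero    = []
  assignment (suc n) = blockBins Fin.zero (Fin.fromℕ (suc n)) ++ map Fin.suc (assignment n)

  length-assignment : ∀ n → length (assignment n) ≡ length (blocks n)
  length-assignment zero    = refl
  length-assignment (suc n) = begin
    length (blockBins Fin.zero last ++ map Fin.suc (assignment n))      ≡⟨ ListP.length-++ (blockBins Fin.zero last) ⟩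
    length (blockBins Fin.zero last) ℕ.+ length (map Fin.suc (assignment n))
      ≡⟨ cong₂ ℕ._+_ (length-blockBins Fin.zero last Fin.zero) (trans (ListP.length-map Fin.suc (assignment n)) (length-assignment n)) ⟩
    length block ℕ.+ length (blocks n)                                  ≡⟨ ListP.length-++ block ⟨
    length (blocks (suc n))                                             ∎
    where
    open ≡-Reasoning
    last : Fin (suc (suc n))
    last = Fin.fromℕ (suc n)

  split-load : ∀ n (j : Fin (suc (suc n))) → loadOf j (assignment (suc n)) (blocks (suc n))
    ≡ addV (loadOf j (blockBins Fin.zero (Fin.fromℕ (suc n))) block) (loadOf j (map Fin.suc (assignment n)) (blocks n))
  split-load n j = loadOf-++ j (blockBins Fin.zero _) (map Fin.suc (assignment n)) block (blocks n)
    (length-blockBins Fin.zero (Fin.fromℕ (suc n)) j)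

  loadOf-last : ∀ n → loadOf (Fin.fromℕ n) (assignment n) (blocks n) ≡ sumV (replicate n W)
  loadOf-last zero    = refl
  loadOf-last (suc n) = trans (split-load n (Fin.fromℕ (suc n))) (cong₂ addV
    (loadOf-blockBins-w Fin.zero last last refl (isYes-true (last Fin.≟ last) refl))
    (trans (loadOf-suc-map-suc (Fin.fromℕ n) (assignment n) (blocks n)) (loadOf-last n)))
    where
    last : Fin (suc (suc n))
    last = Fin.fromℕ (suc n)

  loadOf-inject₁ : ∀ n (j : Fin n) → loadOf (Fin.inject₁ j) (assignment n) (blocks n) ≡ U
  loadOf-inject₁ (suc n) Fin.zero = trans (split-load n Fin.zero) (trans (cong₂ addV
    (loadOf-blockBins-u Fin.zero (Fin.fromℕ (suc n)) Fin.zero refl refl)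
    (loadOf-zero-map-suc (assignment n) (blocks n))) (addV-identityʳ U))
  loadOf-inject₁ (suc n) (Fin.suc j) = trans (split-load n (Fin.suc (Fin.inject₁ j))) (trans (cong₂ addV
    (loadOf-blockBins-none Fin.zero (Fin.fromℕ (suc n)) (Fin.suc (Fin.inject₁ j)) refl
      (trans (suc-≟-suc (Fin.fromℕ n) (Fin.inject₁ j)) (isYes-false (Fin.fromℕ n Fin.≟ Fin.inject₁ j) FinP.fromℕ≢inject₁)))
    (trans (loadOf-suc-map-suc (Fin.inject₁ j) (assignment n) (blocks n)) (loadOf-inject₁ n j))) (addV-identityˡ U))

  blocks-packable : ∀ n (extra : List (Vec ℚ d)) → (∀ i → lookup U i ≤ 1ℚ) →
    (∀ i → ℕtoℚ n * lookup W i + lookup (sumV extra) i ≤ 1ℚ) → Packable (suc n) (blocks n ++ extra)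
  blocks-packable n extra U≤1 W≤1 = packable-by (blocks n ++ extra) (assignment n ++ replicate (length extra) last)
    (begin
      length (assignment n ++ replicate (length extra) last)
        ≡⟨ ListP.length-++ (assignment n) ⟩
      length (assignment n) ℕ.+ length (replicate (length extra) last)
        ≡⟨ cong₂ ℕ._+_ (length-assignment n) (ListP.length-replicate (length extra)) ⟩
      length (blocks n) ℕ.+ length extra
        ≡⟨ ListP.length-++ (blocks n) ⟨
      length (blocks n ++ extra) ∎)
    (λ j → trans (cong leOne (loadOf-++ j (assignment n) _ (blocks n) extra (length-assignment n))) (fits j (fromℕ-or-inject₁ n j)))
    where
    open ≡-Reasoning
    last : Fin (suc n)
    last = Fin.fromℕ n
    fits : ∀ j → j ≡ last ⊎ ∃[ j′ ] j ≡ Fin.inject₁ j′ →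
      leOne (addV (loadOf j (assignment n) (blocks n)) (loadOf j (replicate (length extra) last) extra)) ≡ true
    fits j (inj₁ refl)
      rewrite loadOf-last n | loadOf-replicate-≡ last last (isYes-true (last Fin.≟ last) refl) extra =
      leOne-true (addV (sumV (replicate n W)) (sumV extra)) (λ i → ℚP.≤-trans (ℚP.≤-reflexive
        (trans (lookup-addV (sumV (replicate n W)) (sumV extra) i)
               (cong (_+ lookup (sumV extra) i) (lookup-sumV-replicate n W i))))
        (W≤1 i))
    fits j (inj₂ (j′ , refl))
      rewrite loadOf-inject₁ n j′
            | loadOf-replicate-≢ last (Fin.inject₁ j′) (isYes-false (last Fin.≟ Fin.inject₁ j′) FinP.fromℕ≢inject₁) extra
            | addV-identityʳ U =
      leOne-true U U≤1

-- Lower-bound instances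

LowerBoundWitness : ℕ → ℚ → ℚ → ℚ → Set
LowerBoundWitness d μ ρ δ = ∃[ R ] (ValidInstance {d} R × DurationRatio R μ × ((ρ - δ) * OPT R ≤ costMF R))

durationRatio-1-μ : ∀ {d} (R : Instance d) (μ : ℚ) → 1ℚ ≤ μ →
  All (λ r → duration r ≡ 1ℚ ⊎ duration r ≡ μ) R →
  ∀ {r s} → r ∈ R → s ∈ R → duration r ≡ μ → duration s ≡ 1ℚ → DurationRatio R μ
durationRatio-1-μ R μ 1≤μ durations r∈R s∈R dur-r dur-s =
  (λ r∈R s∈R → bound (All.lookup durations r∈R) (All.lookup durations s∈R)) ,
  (_ , _ , r∈R , s∈R , trans dur-r (trans (sym (ℚP.*-identityʳ μ)) (cong (μ *_) (sym dur-s))))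
  where
  μ≤μ*μ : μ ≤ μ * μ
  μ≤μ*μ = ℚP.≤-trans (ℚP.≤-reflexive (sym (ℚP.*-identityʳ μ))) (*-monoˡ-≤-0≤ (ℚP.≤-trans 0≤1 1≤μ) 1≤μ)
  bound : ∀ {x y} → x ≡ 1ℚ ⊎ x ≡ μ → y ≡ 1ℚ ⊎ y ≡ μ → x ≤ μ * y
  bound (inj₁ refl) (inj₁ refl) = ℚP.≤-trans 1≤μ (ℚP.≤-reflexive (sym (ℚP.*-identityʳ μ)))
  bound (inj₁ refl) (inj₂ refl) = ℚP.≤-trans 1≤μ μ≤μ*μ
  bound (inj₂ refl) (inj₁ refl) = ℚP.≤-reflexive (sym (ℚP.*-identityʳ μ))
  bound (inj₂ refl) (inj₂ refl) = μ≤μ*μ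

arrivals-sorted : ∀ {d} (R : Instance d) (rs : List (ℕ × ℚ)) → map arr R ≡ expand rs →
  Linked _≤_ (map proj₂ rs) → Linked (λ r s → arr r ≤ arr s) R
arrivals-sorted R rs arrivals sorted =
  LinkedP.map⁻ (subst (Linked _≤_) (sym arrivals) (linked-expand rs sorted))

module TwoμFamily (n : ℕ) (μ : ℚ) (1≤μ : 1ℚ ≤ μ)
  (ε : ℚ) (0<ε : 0ℚ < ε) (M*8ε≡1 : ℕtoℚ (suc n) * (ℕtoℚ 8 * ε) ≡ 1ℚ) where

  M : ℕ
  M = suc n

  8ε≤1 : ℕtoℚ 8 * ε ≤ 1ℚ
  8ε≤1 = ℚP.≤-trans (ℚP.≤-reflexive (sym (ℚP.*-identityˡ (ℕtoℚ 8 * ε))))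
    (ℚP.≤-trans (*-monoʳ-≤-0≤ (*-nonNeg (0≤ℕtoℚ 8) (ℚP.<⇒≤ 0<ε)) (ℕtoℚ-mono-≤ (s≤s (z≤n {n}))))
      (ℚP.≤-reflexive M*8ε≡1))

  1-8ε≥0 : 0ℚ ≤ 1ℚ - ℕtoℚ 8 * ε
  1-8ε≥0 = p≤q⇒0≤q-p 8ε≤1

  0≤ε : 0ℚ ≤ ε
  0≤ε = ℚP.<⇒≤ 0<ε

  0≤½ : 0ℚ ≤ ½
  0≤½ = ℚP.<⇒≤ (ℚP.positive⁻¹ ½)

  0<μ : 0ℚ < μ
  0<μ = ℚP.<-≤-trans (ℚP.positive⁻¹ 1ℚ) 1≤μ

  a t : ℚ
  a = ½ - ε
  t = ε + ε + ε + ε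

  big small : Item 1
  big = item 0ℚ 1ℚ (a Vec.∷ Vec.[])
  small = item 0ℚ μ (t Vec.∷ Vec.[])

  small-at-0 : activeAt 0ℚ small ≡ true
  small-at-0 = activeAt-true 0ℚ small ℚP.≤-refl 0<μ

  small-at-1 : (1ℚ < μ × activeAt 1ℚ small ≡ true) ⊎ (μ ≡ 1ℚ × activeAt 1ℚ small ≡ false)
  small-at-1 = by-cases (1ℚ ℚP.<? μ)
    where
    by-cases : Dec (1ℚ < μ) → (1ℚ < μ × activeAt 1ℚ small ≡ true) ⊎ (μ ≡ 1ℚ × activeAt 1ℚ small ≡ false)
    by-cases (yes 1<μ) = inj₁ (1<μ , activeAt-true 1ℚ small 0≤1 1<μ)
    by-cases (no 1≮μ)  = inj₂ (ℚP.≤-antisym (ℚP.≮⇒≥ 1≮μ) 1≤μ , activeAt-after 1ℚ small (ℚP.≮⇒≥ 1≮μ))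

  big-rejected : canAccept big (small ∷ big ∷ []) ≡ false
  big-rejected = canAccept-false big (small ∷ big ∷ []) Fin.zero overflow
    where
    overflow : 1ℚ < load 0ℚ (small ∷ big ∷ []) Fin.zero + a
    overflow rewrite small-at-0 = <-via-difference (ε + ε)
      (solve 1 (λ e → (e :+ e :+ e :+ e :+ ((con ½ :- e) :+ con 0ℚ)) :+ (con ½ :- e) :- con 1ℚ := e :+ e) refl ε)
      (ℚP.+-mono-< 0<ε 0<ε)

  small-accepted : canAccept small (big ∷ []) ≡ true
  small-accepted = canAccept-true small (big ∷ []) refl λ where
    Fin.zero → ≤-via-difference (½ * (1ℚ - ℕtoℚ 8 * ε) + ε)
      (solve 1 (λ e → con 1ℚ :- (((con ½ :- e) :+ con 0ℚ) :+ (e :+ e :+ e :+ e))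
                      := con ½ :* (con 1ℚ :- con (ℕtoℚ 8) :* e) :+ e) refl ε)
      (ℚP.+-mono-≤ (*-nonNeg 0≤½ 1-8ε≥0) 0≤ε)

  open PairPhase {X = ⊤} (const big) (const small) (const (const big-rejected)) (const small-accepted)
    using (IsPairBin; pairs; runFrom-blocks)

  block : Instance 1
  block = pairs (tt ∷ tt ∷ [])

  R : Instance 1
  R = concat (replicate M block)

  span-pairBin : span (small ∷ big ∷ []) ≡ μ
  span-pairBin = trans (span-expand (small ∷ big ∷ []) ((1 , 0ℚ) ∷ (0 , 1ℚ) ∷ (0 , μ) ∷ [])
    (0≤1 ∷ 1≤μ ∷ [-]) (prep 0ℚ (prep 0ℚ (swap 1ℚ μ ↭-refl)))) spans
    where
    spans : spanSeg (small ∷ big ∷ []) 0ℚ 1ℚ + (spanSeg (small ∷ big ∷ []) 1ℚ μ + 0ℚ) ≡ μ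
    spans rewrite small-at-0 with small-at-1
    ... | inj₁ (_ , active)   rewrite active = solve 1 (λ m → (con 1ℚ :- con 0ℚ) :+ ((m :- con 1ℚ) :+ con 0ℚ) := m) refl μ
    ... | inj₂ (μ≡1 , passive) rewrite passive = sym μ≡1

  cost≡ : costMF R ≡ ℕtoℚ M * ℕtoℚ 2 * μ
  cost≡ = begin
    costMF R                           ≡⟨ costMF-uniform R μ (All.map (λ { (_ , refl) → span-pairBin }) (proj₁ run)) ⟩
    ℕtoℚ (length (runMF R)) * μ        ≡⟨ cong (λ k → ℕtoℚ k * μ) (trans (proj₂ run) (ℕP.+-identityʳ (M ℕ.* 2))) ⟩
    ℕtoℚ (M ℕ.* 2) * μ                 ≡⟨ cong (_* μ) (ℕtoℚ-* M 2) ⟩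
    ℕtoℚ M * ℕtoℚ 2 * μ                ∎
    where
    open ≡-Reasoning
    run : All IsPairBin (runMF R) × length (runMF R) ≡ M ℕ.* 2 ℕ.+ 0
    run = runFrom-blocks M (tt ∷ tt ∷ []) []

  open BlockPacking {X = ⊤} (const (a Vec.∷ Vec.[])) (const (t Vec.∷ Vec.[])) (tt ∷ tt ∷ [])
    using (U; W; blocks; blocks-packable)

  -- length R and M ℕ.* 2 are definitionally successors, so these runs have the intended lengths.
  events : List (ℕ × ℚ)
  events = (ℕ.pred (length R) , 0ℚ) ∷ (suc (n ℕ.* 2) , 1ℚ) ∷ (suc (n ℕ.* 2) , μ) ∷ []

  arrivals : map arr R ≡ replicate (length R) 0ℚ
  arrivals = trans (All-≡⇒replicate (AllP.map⁺ (AllP.concat⁺ (AllP.replicate⁺ M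
    (refl ∷ refl ∷ refl ∷ refl ∷ []))))) (cong (λ k → replicate k 0ℚ) (ListP.length-map arr R))

  events-↭ : expand events ↭ map arr R ++ map dep R
  events-↭ = ↭-trans (↭-reflexive (cong (replicate (length R) 0ℚ ++_)
    (cong (replicate (M ℕ.* 2) 1ℚ ++_) (ListP.++-identityʳ (replicate (M ℕ.* 2) μ)))))
    (PermP.++⁺ (↭-reflexive (sym arrivals))
      (↭-sym (↭-trans (↭-reflexive (map-concat-replicate dep M block)) (concat-replicate-↭ M 1ℚ μ))))

  OPT≡ : OPT R ≡ optSeg R 0ℚ 1ℚ + (optSeg R 1ℚ μ + 0ℚ)
  OPT≡ = OPT-expand R events (0≤1 ∷ 1≤μ ∷ [-]) events-↭

  U≤1 : ∀ i → lookup U i ≤ 1ℚ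
  U≤1 Fin.zero = ≤-via-difference (ε + ε)
    (solve 1 (λ e → con 1ℚ :- ((con ½ :- e) :+ ((con ½ :- e) :+ con 0ℚ)) := e :+ e) refl ε)
    (ℚP.+-mono-≤ 0≤ε 0≤ε)

  opt-at-0 : optAt R 0ℚ ℕ.≤ suc M
  opt-at-0 = optBins-≤ _ (suc M) (subst (Packable (suc M)) sizes (blocks-packable M [] U≤1 W≤1))
    where
    sizes : blocks M ++ [] ≡ map size (filterB (activeAt 0ℚ) R)
    sizes = trans (ListP.++-identityʳ (blocks M)) (sym (trans
      (cong (map size) (filterB-keeps-all (activeAt 0ℚ)
        (AllP.concat⁺ (AllP.replicate⁺ M (refl ∷ small-at-0 ∷ refl ∷ small-at-0 ∷ [])))))
      (map-concat-replicate size M block)))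
    W≤1 : ∀ i → ℕtoℚ M * lookup W i + lookup (sumV []) i ≤ 1ℚ
    W≤1 Fin.zero = ℚP.≤-reflexive (trans
      (solve 2 (λ m e → m :* ((e :+ e :+ e :+ e) :+ ((e :+ e :+ e :+ e) :+ con 0ℚ)) :+ con 0ℚ
                      := m :* (con (ℕtoℚ 8) :* e)) refl (ℕtoℚ M) ε) M*8ε≡1)

  opt-at-1 : optAt R 1ℚ ℕ.≤ 1
  opt-at-1 with small-at-1
  ... | inj₁ (_ , active) = subst (λ F → optBins (map size F) ℕ.≤ 1) (sym smalls)
    (optBins-≤ extra 1 (blocks-packable 0 extra U≤1 fits))
    where
    extra : List (Vec ℚ 1)
    extra = map size (concat (replicate M (small ∷ small ∷ [])))
    block-smalls : filterB (activeAt 1ℚ) block ≡ small ∷ small ∷ []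
    block-smalls rewrite active = refl
    smalls : filterB (activeAt 1ℚ) R ≡ concat (replicate M (small ∷ small ∷ []))
    smalls = trans (filterB-concat-replicate (activeAt 1ℚ) M block) (cong (λ F → concat (replicate M F)) block-smalls)
    fits : ∀ i → ℕtoℚ 0 * lookup W i + lookup (sumV extra) i ≤ 1ℚ
    fits Fin.zero = begin
      ℕtoℚ 0 * lookup W Fin.zero + lookup (sumV extra) Fin.zero
        ≡⟨ cong (_+ lookup (sumV extra) Fin.zero) (ℚP.*-zeroˡ (lookup W Fin.zero)) ⟩
      0ℚ + lookup (sumV extra) Fin.zero
        ≡⟨ ℚP.+-identityˡ (lookup (sumV extra) Fin.zero) ⟩
      lookup (sumV extra) Fin.zero
        ≤⟨ lookup-sumV-≤ extra t Fin.zero (AllP.map⁺ (AllP.concat⁺ (AllP.replicate⁺ M (ℚP.≤-refl ∷ ℚP.≤-refl ∷ [])))) ⟩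
      ℕtoℚ (length extra) * t
        ≡⟨ cong (λ k → ℕtoℚ k * t) (trans (ListP.length-map size (concat (replicate M (small ∷ small ∷ []))))
                                           (length-concat-replicate M (small ∷ small ∷ []))) ⟩
      ℕtoℚ (M ℕ.* 2) * t
        ≡⟨ cong (_* t) (ℕtoℚ-* M 2) ⟩
      ℕtoℚ M * ℕtoℚ 2 * t
        ≡⟨ solve 2 (λ m e → m :* con (ℕtoℚ 2) :* (e :+ e :+ e :+ e) := m :* (con (ℕtoℚ 8) :* e)) refl (ℕtoℚ M) ε ⟩
      ℕtoℚ M * (ℕtoℚ 8 * ε)
        ≡⟨ M*8ε≡1 ⟩
      1ℚ ∎
      where open ℚP.≤-Reasoning
  ... | inj₂ (_ , passive) = subst (λ F → optBins (map size F) ℕ.≤ 1) (sym none) z≤n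
    where
    none : filterB (activeAt 1ℚ) R ≡ []
    none = filterB-drops-all (activeAt 1ℚ) {R} (AllP.concat⁺ (AllP.replicate⁺ M (refl ∷ passive ∷ refl ∷ passive ∷ [])))

  OPT≤ : OPT R ≤ ℕtoℚ M + μ
  OPT≤ = begin
    OPT R                                                                  ≡⟨ OPT≡ ⟩
    (1ℚ - 0ℚ) * ℕtoℚ (optAt R 0ℚ) + ((μ - 1ℚ) * ℕtoℚ (optAt R 1ℚ) + 0ℚ)
      ≤⟨ ℚP.+-mono-≤ (*-monoˡ-≤-0≤ (p≤q⇒0≤q-p 0≤1) (ℕtoℚ-mono-≤ opt-at-0))
                     (ℚP.+-monoˡ-≤ 0ℚ (*-monoˡ-≤-0≤ (p≤q⇒0≤q-p 1≤μ) (ℕtoℚ-mono-≤ opt-at-1))) ⟩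
    (1ℚ - 0ℚ) * ℕtoℚ (suc M) + ((μ - 1ℚ) * 1ℚ + 0ℚ)
      ≡⟨ cong (λ x → (1ℚ - 0ℚ) * x + ((μ - 1ℚ) * 1ℚ + 0ℚ)) (ℕtoℚ-suc M) ⟩
    (1ℚ - 0ℚ) * (1ℚ + ℕtoℚ M) + ((μ - 1ℚ) * 1ℚ + 0ℚ)
      ≡⟨ solve 2 (λ m x → (con 1ℚ :- con 0ℚ) :* (con 1ℚ :+ x) :+ ((m :- con 1ℚ) :* con 1ℚ :+ con 0ℚ) := x :+ m)
                 refl μ (ℕtoℚ M) ⟩
    ℕtoℚ M + μ ∎
    where open ℚP.≤-Reasoning

  valid-big : ValidItem big
  valid-big = ℚP.≤-refl , ℚP.positive⁻¹ 1ℚ ,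
    ( ≤-via-difference (½ * (1ℚ - ℕtoℚ 8 * ε) + (ε + ε + ε))
        (solve 1 (λ e → (con ½ :- e) :- con 0ℚ := con ½ :* (con 1ℚ :- con (ℕtoℚ 8) :* e) :+ (e :+ e :+ e)) refl ε)
        (ℚP.+-mono-≤ (*-nonNeg 0≤½ 1-8ε≥0) (ℚP.+-mono-≤ (ℚP.+-mono-≤ 0≤ε 0≤ε) 0≤ε))
    , ≤-via-difference (½ + ε) (solve 1 (λ e → con 1ℚ :- (con ½ :- e) := con ½ :+ e) refl ε) (ℚP.+-mono-≤ 0≤½ 0≤ε))
    VecAll.∷ VecAll.[]

  valid-small : ValidItem small
  valid-small = ℚP.≤-refl , 0<μ ,
    ( ℚP.+-mono-≤ (ℚP.+-mono-≤ (ℚP.+-mono-≤ 0≤ε 0≤ε) 0≤ε) 0≤ε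
    , ≤-via-difference (½ * (1ℚ - ℕtoℚ 8 * ε) + ½)
        (solve 1 (λ e → con 1ℚ :- (e :+ e :+ e :+ e) := con ½ :* (con 1ℚ :- con (ℕtoℚ 8) :* e) :+ con ½) refl ε)
        (ℚP.+-mono-≤ (*-nonNeg 0≤½ 1-8ε≥0) 0≤½))
    VecAll.∷ VecAll.[]

  valid : ValidInstance R
  valid = AllP.concat⁺ (AllP.replicate⁺ M (valid-big ∷ valid-small ∷ valid-big ∷ valid-small ∷ []))
        , arrivals-sorted R ((ℕ.pred (length R) , 0ℚ) ∷ []) (trans arrivals (sym (ListP.++-identityʳ _))) [-]

  duration-small : duration small ≡ μ
  duration-small = ℚP.+-identityʳ μ

  ratio : DurationRatio R μ
  ratio = durationRatio-1-μ R μ 1≤μ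
    (AllP.concat⁺ (AllP.replicate⁺ M (inj₁ refl ∷ inj₂ duration-small ∷ inj₁ refl ∷ inj₂ duration-small ∷ [])))
    (there (here refl)) (here refl) duration-small refl

  competitive : ∀ δ → 0ℚ ≤ δ → ℕtoℚ 2 * μ * μ ≤ δ * ℕtoℚ M → (ℕtoℚ 2 * μ - δ) * OPT R ≤ costMF R
  competitive δ 0≤δ 2μμ≤δM = *-≤-via-upper-bound {ℕtoℚ 2 * μ - δ} (OPT-nonNeg R) OPT≤
    (ℚP.≤-trans (*-nonNeg (*-nonNeg (0≤ℕtoℚ M) (0≤ℕtoℚ 2)) (ℚP.≤-trans 0≤1 1≤μ)) (ℚP.≤-reflexive (sym cost≡)))
    (ℚP.≤-trans (≤-via-difference ((δ * ℕtoℚ M - ℕtoℚ 2 * μ * μ) + δ * μ)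
      (solve 3 (λ m μ δ → m :* con (ℕtoℚ 2) :* μ :- (con (ℕtoℚ 2) :* μ :- δ) :* (m :+ μ)
                          := (δ :* m :- con (ℕtoℚ 2) :* μ :* μ) :+ δ :* μ) refl (ℕtoℚ M) μ δ)
      (ℚP.+-mono-≤ (p≤q⇒0≤q-p 2μμ≤δM) (*-nonNeg 0≤δ (ℚP.≤-trans 0≤1 1≤μ))))
      (ℚP.≤-reflexive (sym cost≡)))

twoμ-lowerBound : ∀ μ → 1ℚ ≤ μ → ∀ δ → 0ℚ < δ → LowerBoundWitness 1 μ (ℕtoℚ 2 * μ) δ
twoμ-lowerBound μ 1≤μ δ 0<δ = R , valid , ratio , competitive δ (ℚP.<⇒≤ 0<δ) 2μμ≤δM
  where
  k : ℕ
  k = proj₁ (archimedean-suc 0<δ (ℕtoℚ 2 * μ * μ))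
  2μμ≤δM : ℕtoℚ 2 * μ * μ ≤ δ * ℕtoℚ (suc k)
  2μμ≤δM = proj₂ (archimedean-suc 0<δ (ℕtoℚ 2 * μ * μ))
  M*8ε≡1 : ℕtoℚ (suc k) * (ℕtoℚ 8 * 1/suc (7 ℕ.+ k ℕ.* 8)) ≡ 1ℚ
  M*8ε≡1 = trans (sym (ℚP.*-assoc (ℕtoℚ (suc k)) (ℕtoℚ 8) (1/suc (7 ℕ.+ k ℕ.* 8))))
    (trans (cong (_* 1/suc (7 ℕ.+ k ℕ.* 8)) (sym (ℕtoℚ-* (suc k) 8))) (ℕtoℚ-suc*1/suc (7 ℕ.+ k ℕ.* 8)))
  open TwoμFamily k μ 1≤μ (1/suc (7 ℕ.+ k ℕ.* 8)) (0<1/suc (7 ℕ.+ k ℕ.* 8)) M*8ε≡1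

module DimensionFamily (d′ m : ℕ) (μ : ℚ) (1≤μ : 1ℚ ≤ μ)
  (s : ℚ) (0<s : 0ℚ < s) (s<1 : s < 1ℚ) (M[1-s]≤1 : ℕtoℚ (suc m) * (1ℚ - s) ≤ 1ℚ)
  (ε : ℚ) (0<ε : 0ℚ < ε) (Md4ε≡1 : ℕtoℚ (suc m) * ℕtoℚ (suc d′) * (ℕtoℚ 4 * ε) ≡ 1ℚ) where

  d M T : ℕ
  d = suc d′
  M = suc m
  T = M ℕ.* d

  0≤ε : 0ℚ ≤ ε
  0≤ε = ℚP.<⇒≤ 0<ε

  0≤s : 0ℚ ≤ s
  0≤s = ℚP.<⇒≤ 0<s

  0<μ : 0ℚ < μ
  0<μ = ℚP.<-≤-trans (ℚP.positive⁻¹ 1ℚ) 1≤μ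

  s<s+μ : s < s + μ
  s<s+μ = ℚP.≤-<-trans (ℚP.≤-reflexive (sym (ℚP.+-identityʳ s))) (ℚP.+-monoʳ-< s 0<μ)

  1<s+μ : 1ℚ < s + μ
  1<s+μ = ℚP.≤-<-trans (ℚP.≤-reflexive (sym (ℚP.+-identityˡ 1ℚ))) (ℚP.+-mono-<-≤ 0<s 1≤μ)

  4ε≤1 : ℕtoℚ 4 * ε ≤ 1ℚ
  4ε≤1 = ℚP.≤-trans (ℚP.≤-reflexive (sym (ℚP.*-identityˡ (ℕtoℚ 4 * ε))))
    (ℚP.≤-trans (*-monoʳ-≤-0≤ (*-nonNeg (0≤ℕtoℚ 4) 0≤ε) (ℕtoℚ-mono-≤ (s≤s (z≤n {ℕ.pred T}))))
      (ℚP.≤-reflexive (trans (cong (_* (ℕtoℚ 4 * ε)) (ℕtoℚ-* M d)) Md4ε≡1)))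

  1-4ε≥0 : 0ℚ ≤ 1ℚ - ℕtoℚ 4 * ε
  1-4ε≥0 = p≤q⇒0≤q-p 4ε≤1

  bigS filS : Fin d → Vec ℚ d
  bigS c = spike c (1ℚ - (ε + ε)) 0ℚ
  filS c = spike c ε (ε + ε + ε)

  tinyS : Vec ℚ d
  tinyS = Vec.replicate d ε

  big fil : Fin d → Item d
  big c = item 0ℚ 1ℚ (bigS c)
  fil c = item 0ℚ 1ℚ (filS c)

  tiny : Item d
  tiny = item s (s + μ) tinyS

  lookup-tinyS : ∀ i → lookup tinyS i ≡ ε
  lookup-tinyS i = VecP.lookup-replicate i ε

  -- fil c and big c share the interval [0, 1), so rewriting with this also settles big c.
  pair-active-at-s : ∀ c → activeAt s (fil c) ≡ true
  pair-active-at-s c = activeAt-true s (fil c) 0≤s s<1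

  big-rejected : ∀ c c′ → canAccept (big c) (fil c′ ∷ big c′ ∷ []) ≡ false
  big-rejected c c′ = canAccept-false (big c) (fil c′ ∷ big c′ ∷ []) c (overflow (c′ Fin.≟ c))
    where
    overflow : Dec (c′ ≡ c) → 1ℚ < load 0ℚ (fil c′ ∷ big c′ ∷ []) c + lookup (bigS c) c
    overflow (yes refl) rewrite lookup-spike-≡ c ε (ε + ε + ε) | lookup-spike-≡ c (1ℚ - (ε + ε)) 0ℚ =
      <-via-difference ((1ℚ - ℕtoℚ 4 * ε) + ε)
        (solve 1 (λ e → (e :+ ((con 1ℚ :- (e :+ e)) :+ con 0ℚ)) :+ (con 1ℚ :- (e :+ e)) :- con 1ℚ
                        := (con 1ℚ :- con (ℕtoℚ 4) :* e) :+ e) refl ε)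
        (ℚP.≤-<-trans (ℚP.≤-reflexive (sym (ℚP.+-identityʳ 0ℚ))) (ℚP.+-mono-≤-< 1-4ε≥0 0<ε))
    overflow (no c′≢c) rewrite lookup-spike-≢ c′ c ε (ε + ε + ε) c′≢c | lookup-spike-≢ c′ c (1ℚ - (ε + ε)) 0ℚ c′≢c
      | lookup-spike-≡ c (1ℚ - (ε + ε)) 0ℚ =
      <-via-difference ε
        (solve 1 (λ e → ((e :+ e :+ e) :+ (con 0ℚ :+ con 0ℚ)) :+ (con 1ℚ :- (e :+ e)) :- con 1ℚ := e) refl ε) 0<ε

  fil-accepted : ∀ c → canAccept (fil c) (big c ∷ []) ≡ true
  fil-accepted c = canAccept-true (fil c) (big c ∷ []) refl (λ i → fits i (c Fin.≟ i))
    where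
    fits : ∀ i → Dec (c ≡ i) → load 0ℚ (big c ∷ []) i + lookup (filS c) i ≤ 1ℚ
    fits i (yes refl) rewrite lookup-spike-≡ c (1ℚ - (ε + ε)) 0ℚ | lookup-spike-≡ c ε (ε + ε + ε) =
      ≤-via-difference ε (solve 1 (λ e → con 1ℚ :- (((con 1ℚ :- (e :+ e)) :+ con 0ℚ) :+ e) := e) refl ε) 0≤ε
    fits i (no c≢i) rewrite lookup-spike-≢ c i (1ℚ - (ε + ε)) 0ℚ c≢i | lookup-spike-≢ c i ε (ε + ε + ε) c≢i =
      ≤-via-difference ((1ℚ - ℕtoℚ 4 * ε) + ε)
        (solve 1 (λ e → con 1ℚ :- ((con 0ℚ :+ con 0ℚ) :+ (e :+ e :+ e)) := (con 1ℚ :- con (ℕtoℚ 4) :* e) :+ e) refl ε)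
        (ℚP.+-mono-≤ 1-4ε≥0 0≤ε)

  tiny-accepted : ∀ c → canAccept tiny (fil c ∷ big c ∷ []) ≡ true
  tiny-accepted c = canAccept-true tiny (fil c ∷ big c ∷ []) open-bin (λ i → fits i (c Fin.≟ i))
    where
    open-bin : binOpenAt s (fil c ∷ big c ∷ []) ≡ true
    open-bin rewrite pair-active-at-s c = refl
    fits : ∀ i → Dec (c ≡ i) → load s (fil c ∷ big c ∷ []) i + lookup tinyS i ≤ 1ℚ
    fits i (yes refl) rewrite pair-active-at-s c | lookup-tinyS c
      | lookup-spike-≡ c ε (ε + ε + ε) | lookup-spike-≡ c (1ℚ - (ε + ε)) 0ℚ =
      ℚP.≤-reflexive (solve 1 (λ e → (e :+ ((con 1ℚ :- (e :+ e)) :+ con 0ℚ)) :+ e := con 1ℚ) refl ε)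
    fits i (no c≢i) rewrite pair-active-at-s c | lookup-tinyS i
      | lookup-spike-≢ c i ε (ε + ε + ε) c≢i | lookup-spike-≢ c i (1ℚ - (ε + ε)) 0ℚ c≢i =
      ≤-via-difference (1ℚ - ℕtoℚ 4 * ε)
        (solve 1 (λ e → con 1ℚ :- (((e :+ e :+ e) :+ (con 0ℚ :+ con 0ℚ)) :+ e) := con 1ℚ :- con (ℕtoℚ 4) :* e) refl ε)
        1-4ε≥0

  tiny-rejected : ∀ c → canAccept tiny (tiny ∷ fil c ∷ big c ∷ []) ≡ false
  tiny-rejected c = canAccept-false tiny (tiny ∷ fil c ∷ big c ∷ []) c overflow
    where
    overflow : 1ℚ < load s (tiny ∷ fil c ∷ big c ∷ []) c + lookup tinyS c
    overflow rewrite activeAt-true s tiny ℚP.≤-refl s<s+μ | pair-active-at-s c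
      | lookup-tinyS c | lookup-spike-≡ c ε (ε + ε + ε) | lookup-spike-≡ c (1ℚ - (ε + ε)) 0ℚ =
      <-via-difference ε
        (solve 1 (λ e → (e :+ (e :+ ((con 1ℚ :- (e :+ e)) :+ con 0ℚ))) :+ e :- con 1ℚ := e) refl ε) 0<ε

  Full : Bin d → Set
  Full b = ∃[ c ] b ≡ tiny ∷ fil c ∷ big c ∷ []

  open PairPhase big fil big-rejected fil-accepted using (IsPairBin; pairs; All-pairs; map-size-pairs; runFrom-blocks)

  tiny-accepted-by-pair : ∀ {b} → IsPairBin b → canAccept tiny b ≡ true
  tiny-accepted-by-pair (c , refl) = tiny-accepted c

  tiny-rejected-by-full : ∀ {b} → Full b → canAccept tiny b ≡ false
  tiny-rejected-by-full (c , refl) = tiny-rejected c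

  tiny-fills-pair : ∀ {b} → IsPairBin b → Full (tiny ∷ b)
  tiny-fills-pair (c , refl) = c , refl

  open TailPhase tiny IsPairBin Full tiny-accepted-by-pair tiny-rejected-by-full tiny-fills-pair using (runFrom-tail)

  cs : List (Fin d)
  cs = allFin d

  R₀ R : Instance d
  R₀ = concat (replicate M (pairs cs))
  R  = R₀ ++ replicate T tiny

  span-full : ∀ c → span (tiny ∷ fil c ∷ big c ∷ []) ≡ s + μ
  span-full c = trans (span-expand (tiny ∷ fil c ∷ big c ∷ []) ((1 , 0ℚ) ∷ (0 , s) ∷ (1 , 1ℚ) ∷ (0 , s + μ) ∷ [])
    (0≤s ∷ ℚP.<⇒≤ s<1 ∷ ℚP.<⇒≤ 1<s+μ ∷ [-])
    (↭-trans (PermP.shift s (0ℚ ∷ 0ℚ ∷ []) (1ℚ ∷ 1ℚ ∷ s + μ ∷ []))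
      (prep s (prep 0ℚ (prep 0ℚ (PermP.shift (s + μ) (1ℚ ∷ 1ℚ ∷ []) []))))))
    spans
    where
    spans : spanSeg (tiny ∷ fil c ∷ big c ∷ []) 0ℚ s + (spanSeg (tiny ∷ fil c ∷ big c ∷ []) s 1ℚ
            + (spanSeg (tiny ∷ fil c ∷ big c ∷ []) 1ℚ (s + μ) + 0ℚ)) ≡ s + μ
    spans rewrite activeAt-before 0ℚ tiny 0<s | activeAt-true s tiny ℚP.≤-refl s<s+μ
      | activeAt-true 1ℚ tiny (ℚP.<⇒≤ s<1) 1<s+μ =
      solve 2 (λ s m → (s :- con 0ℚ) :+ ((con 1ℚ :- s) :+ (((s :+ m) :- con 1ℚ) :+ con 0ℚ)) := s :+ m) refl s μ

  cost≡ : costMF R ≡ ℕtoℚ T * (s + μ)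
  cost≡ = begin
    costMF R
      ≡⟨ costMF-uniform R (s + μ) (subst (All (λ b → span b ≡ s + μ)) (sym run)
           (All.map (λ { (c , refl) → span-full c }) (proj₁ tail))) ⟩
    ℕtoℚ (length (runMF R)) * (s + μ)
      ≡⟨ cong (λ k → ℕtoℚ k * (s + μ)) (trans (cong length run) (trans (proj₂ tail) #pairBins)) ⟩
    ℕtoℚ T * (s + μ) ∎
    where
    open ≡-Reasoning
    pairBins : List (Bin d)
    pairBins = runFrom [] R₀
    #pairBins : length pairBins ≡ T
    #pairBins = trans (proj₂ (runFrom-blocks M cs [])) (trans (ℕP.+-identityʳ (M ℕ.* length cs))
      (cong (M ℕ.*_) (ListP.length-tabulate {n = d} (λ c → c))))
    tail : All Full (runFrom pairBins (replicate (length pairBins) tiny))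
         × length (runFrom pairBins (replicate (length pairBins) tiny)) ≡ 0 ℕ.+ length pairBins
    tail = runFrom-tail {[]} pairBins [] (proj₁ (runFrom-blocks M cs []))
    run : runMF R ≡ runFrom pairBins (replicate (length pairBins) tiny)
    run = trans (runFrom-++ [] R₀ (replicate T tiny)) (cong (λ k → runFrom pairBins (replicate k tiny)) (sym #pairBins))

  pair-times : All (λ r → arr r ≡ 0ℚ × dep r ≡ 1ℚ) R₀
  pair-times = AllP.concat⁺ (AllP.replicate⁺ M (All-pairs (λ _ → refl , refl) (λ _ → refl , refl) cs))

  -- length R₀ and T are definitionally successors, so these runs have the intended lengths.
  events : List (ℕ × ℚ)
  events = (ℕ.pred (length R₀) , 0ℚ) ∷ (ℕ.pred T , s) ∷ (ℕ.pred (length R₀) , 1ℚ) ∷ (ℕ.pred T , s + μ) ∷ []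

  endpoints-R : map arr R ++ map dep R ≡ expand events
  endpoints-R = begin
    map arr R ++ map dep R
      ≡⟨ cong₂ _++_ (ListP.map-++ arr R₀ (replicate T tiny)) (ListP.map-++ dep R₀ (replicate T tiny)) ⟩
    (map arr R₀ ++ map arr (replicate T tiny)) ++ (map dep R₀ ++ map dep (replicate T tiny))
      ≡⟨ cong₂ (λ xs ys → (xs ++ map arr (replicate T tiny)) ++ (ys ++ map dep (replicate T tiny)))
           (same-times arr proj₁) (same-times dep proj₂) ⟩
    (replicate a 0ℚ ++ map arr (replicate T tiny)) ++ (replicate a 1ℚ ++ map dep (replicate T tiny))
      ≡⟨ cong₂ (λ xs ys → (replicate a 0ℚ ++ xs) ++ (replicate a 1ℚ ++ ys)) (ListP.map-replicate arr T tiny) (ListP.map-replicate dep T tiny) ⟩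
    (replicate a 0ℚ ++ replicate T s) ++ (replicate a 1ℚ ++ replicate T (s + μ))
      ≡⟨ ListP.++-assoc (replicate a 0ℚ) (replicate T s) _ ⟩
    replicate a 0ℚ ++ replicate T s ++ replicate a 1ℚ ++ replicate T (s + μ)
      ≡⟨ cong (λ xs → replicate a 0ℚ ++ replicate T s ++ replicate a 1ℚ ++ xs) (ListP.++-identityʳ (replicate T (s + μ))) ⟨
    expand events ∎
    where
    open ≡-Reasoning
    a : ℕ
    a = length R₀
    same-times : ∀ (f : Item d → ℚ) {x} → (∀ {r} → arr r ≡ 0ℚ × dep r ≡ 1ℚ → f r ≡ x) → map f R₀ ≡ replicate a x
    same-times f {x} pick = trans (All-≡⇒replicate (AllP.map⁺ (All.map pick pair-times))) (cong (λ k → replicate k x) (ListP.length-map f R₀))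

  OPT≡ : OPT R ≡ optSeg R 0ℚ s + (optSeg R s 1ℚ + (optSeg R 1ℚ (s + μ) + 0ℚ))
  OPT≡ = OPT-expand R events (0≤s ∷ ℚP.<⇒≤ s<1 ∷ ℚP.<⇒≤ 1<s+μ ∷ [-]) (↭-reflexive (sym endpoints-R))

  open BlockPacking bigS filS cs using (U; W; blocks; blocks-packable)

  sizes-R₀ : map size R₀ ≡ blocks M
  sizes-R₀ = trans (map-concat-replicate size M (pairs cs)) (cong (λ vs → concat (replicate M vs)) (map-size-pairs cs))

  U≤1 : ∀ i → lookup U i ≤ 1ℚ
  U≤1 i = ≤-via-difference (ε + ε) (trans (cong (1ℚ -_) (sum-spikes d i (1ℚ - (ε + ε))))
    (solve 1 (λ e → con 1ℚ :- (con 1ℚ :- (e :+ e)) := e :+ e) refl ε)) (ℚP.+-mono-≤ 0≤ε 0≤ε)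

  W≤ : ∀ i → lookup W i ≤ ℕtoℚ d * (ε + ε + ε)
  W≤ i = ℚP.≤-trans (lookup-sumV-≤ (map filS cs) (ε + ε + ε) i (AllP.map⁺ (AllP.tabulate⁺ filS≤)))
    (ℚP.≤-reflexive (cong (λ k → ℕtoℚ k * (ε + ε + ε)) (trans (ListP.length-map filS cs) (ListP.length-tabulate {n = d} (λ c → c)))))
    where
    filS≤ : ∀ c → lookup (filS c) i ≤ ε + ε + ε
    filS≤ c = spike-cases {P = _≤ ε + ε + ε} c i ε (ε + ε + ε)
      (λ _ → ≤-via-difference (ε + ε) (solve 1 (λ e → (e :+ e :+ e) :- e := e :+ e) refl ε) (ℚP.+-mono-≤ 0≤ε 0≤ε))
      (λ _ → ℚP.≤-refl)

  fits : ∀ j k → j ℕ.≤ M → k ℕ.≤ T → ∀ i → ℕtoℚ j * lookup W i + lookup (sumV (replicate k tinyS)) i ≤ 1ℚ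
  fits j k j≤M k≤T i = begin
    ℕtoℚ j * lookup W i + lookup (sumV (replicate k tinyS)) i
      ≡⟨ cong (ℕtoℚ j * lookup W i +_) (trans (lookup-sumV-replicate k tinyS i) (cong (ℕtoℚ k *_) (lookup-tinyS i))) ⟩
    ℕtoℚ j * lookup W i + ℕtoℚ k * ε
      ≤⟨ ℚP.+-mono-≤ (ℚP.≤-trans (*-monoˡ-≤-0≤ (0≤ℕtoℚ j) (W≤ i)) (*-monoʳ-≤-0≤ d3ε≥0 (ℕtoℚ-mono-≤ j≤M)))
                     (*-monoʳ-≤-0≤ 0≤ε (ℕtoℚ-mono-≤ k≤T)) ⟩
    ℕtoℚ M * (ℕtoℚ d * (ε + ε + ε)) + ℕtoℚ T * ε
      ≡⟨ cong (λ x → ℕtoℚ M * (ℕtoℚ d * (ε + ε + ε)) + x * ε) (ℕtoℚ-* M d) ⟩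
    ℕtoℚ M * (ℕtoℚ d * (ε + ε + ε)) + ℕtoℚ M * ℕtoℚ d * ε
      ≡⟨ solve 3 (λ m d e → m :* (d :* (e :+ e :+ e)) :+ m :* d :* e := m :* d :* (con (ℕtoℚ 4) :* e)) refl (ℕtoℚ M) (ℕtoℚ d) ε ⟩
    ℕtoℚ M * ℕtoℚ d * (ℕtoℚ 4 * ε)
      ≡⟨ Md4ε≡1 ⟩
    1ℚ ∎
    where
    open ℚP.≤-Reasoning
    d3ε≥0 : 0ℚ ≤ ℕtoℚ d * (ε + ε + ε)
    d3ε≥0 = *-nonNeg (0≤ℕtoℚ d) (ℚP.+-mono-≤ (ℚP.+-mono-≤ 0≤ε 0≤ε) 0≤ε)

  active-sizes : ∀ t → All (λ r → activeAt t r ≡ true) R₀ → ∀ {k} → filterB (activeAt t) (replicate T tiny) ≡ replicate k tiny →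
    map size (filterB (activeAt t) R) ≡ blocks M ++ replicate k tinyS
  active-sizes t R₀-active {k} tinies-active = begin
    map size (filterB (activeAt t) R)                                    ≡⟨ cong (map size) (filterB-++ (activeAt t) R₀ (replicate T tiny)) ⟩
    map size (filterB (activeAt t) R₀ ++ filterB (activeAt t) (replicate T tiny))
      ≡⟨ cong₂ (λ xs ys → map size (xs ++ ys)) (filterB-keeps-all (activeAt t) R₀-active) tinies-active ⟩
    map size (R₀ ++ replicate k tiny)                                    ≡⟨ ListP.map-++ size R₀ (replicate k tiny) ⟩
    map size R₀ ++ map size (replicate k tiny)                           ≡⟨ cong₂ _++_ sizes-R₀ (ListP.map-replicate size k tiny) ⟩
    blocks M ++ replicate k tinyS                                        ∎
    where open ≡-Reasoning

  R₀-active : ∀ t → 0ℚ ≤ t → t < 1ℚ → All (λ r → activeAt t r ≡ true) R₀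
  R₀-active t 0≤t t<1 = All.map (λ { {r} (a≡0 , e≡1) →
    activeAt-true t r (subst (_≤ t) (sym a≡0) 0≤t) (subst (t <_) (sym e≡1) t<1) }) pair-times

  opt-at-0 : optAt R 0ℚ ℕ.≤ suc M
  opt-at-0 = optBins-≤ _ (suc M) (subst (Packable (suc M)) (sym (active-sizes 0ℚ (R₀-active 0ℚ ℚP.≤-refl (ℚP.positive⁻¹ 1ℚ))
    (filterB-drops-all (activeAt 0ℚ) (AllP.replicate⁺ T (activeAt-before 0ℚ tiny 0<s)))))
    (blocks-packable M [] U≤1 (fits M 0 ℕP.≤-refl z≤n)))

  opt-at-s : optAt R s ℕ.≤ suc M
  opt-at-s = optBins-≤ _ (suc M) (subst (Packable (suc M)) (sym (active-sizes s (R₀-active s 0≤s s<1)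
    (filterB-keeps-all (activeAt s) (AllP.replicate⁺ T (activeAt-true s tiny ℚP.≤-refl s<s+μ)))))
    (blocks-packable M (replicate T tinyS) U≤1 (fits M T ℕP.≤-refl ℕP.≤-refl)))

  opt-at-1 : optAt R 1ℚ ℕ.≤ 1
  opt-at-1 = optBins-≤ _ 1 (subst (Packable 1) (sym tinies)
    (blocks-packable 0 (replicate T tinyS) U≤1 (fits 0 T z≤n ℕP.≤-refl)))
    where
    tinies : map size (filterB (activeAt 1ℚ) R) ≡ replicate T tinyS
    tinies = begin
      map size (filterB (activeAt 1ℚ) R)      ≡⟨ cong (map size) (filterB-++ (activeAt 1ℚ) R₀ (replicate T tiny)) ⟩
      map size (filterB (activeAt 1ℚ) R₀ ++ filterB (activeAt 1ℚ) (replicate T tiny))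
        ≡⟨ cong₂ (λ xs ys → map size (xs ++ ys))
             (filterB-drops-all (activeAt 1ℚ) (All.map (λ { {r} (_ , e≡1) → activeAt-after 1ℚ r (ℚP.≤-reflexive e≡1) }) pair-times))
             (filterB-keeps-all (activeAt 1ℚ) (AllP.replicate⁺ T (activeAt-true 1ℚ tiny (ℚP.<⇒≤ s<1) 1<s+μ))) ⟩
      map size (replicate T tiny)              ≡⟨ ListP.map-replicate size T tiny ⟩
      replicate T tinyS                        ∎
      where open ≡-Reasoning

  OPT≤ : OPT R ≤ ℕtoℚ M + (s + μ)
  OPT≤ = begin
    OPT R ≡⟨ OPT≡ ⟩
    (s - 0ℚ) * ℕtoℚ (optAt R 0ℚ) + ((1ℚ - s) * ℕtoℚ (optAt R s) + ((s + μ - 1ℚ) * ℕtoℚ (optAt R 1ℚ) + 0ℚ))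
      ≤⟨ ℚP.+-mono-≤ (*-monoˡ-≤-0≤ (p≤q⇒0≤q-p 0≤s) (ℕtoℚ-mono-≤ opt-at-0))
           (ℚP.+-mono-≤ (*-monoˡ-≤-0≤ (p≤q⇒0≤q-p (ℚP.<⇒≤ s<1)) (ℕtoℚ-mono-≤ opt-at-s))
             (ℚP.+-monoˡ-≤ 0ℚ (*-monoˡ-≤-0≤ (p≤q⇒0≤q-p (ℚP.<⇒≤ 1<s+μ)) (ℕtoℚ-mono-≤ opt-at-1)))) ⟩
    (s - 0ℚ) * ℕtoℚ (suc M) + ((1ℚ - s) * ℕtoℚ (suc M) + ((s + μ - 1ℚ) * 1ℚ + 0ℚ))
      ≡⟨ cong (λ x → (s - 0ℚ) * x + ((1ℚ - s) * x + ((s + μ - 1ℚ) * 1ℚ + 0ℚ))) (ℕtoℚ-suc M) ⟩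
    (s - 0ℚ) * (1ℚ + ℕtoℚ M) + ((1ℚ - s) * (1ℚ + ℕtoℚ M) + ((s + μ - 1ℚ) * 1ℚ + 0ℚ))
      ≡⟨ solve 3 (λ s m x → (s :- con 0ℚ) :* (con 1ℚ :+ x) :+ ((con 1ℚ :- s) :* (con 1ℚ :+ x) :+ (((s :+ m) :- con 1ℚ) :* con 1ℚ :+ con 0ℚ))
                 := x :+ (s :+ m)) refl s μ (ℕtoℚ M) ⟩
    ℕtoℚ M + (s + μ) ∎
    where open ℚP.≤-Reasoning

  InUnit : ℚ → Set
  InUnit x = 0ℚ ≤ x × x ≤ 1ℚ

  spike-InUnit : (c : Fin d) {x y : ℚ} → InUnit x → InUnit y → VecAll.All InUnit (spike c x y)
  spike-InUnit c {x} {y} x∈ y∈ = VecAllP.lookup⁻ (λ i → spike-cases {P = InUnit} c i x y (λ _ → x∈) (λ _ → y∈))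

  ε∈ : InUnit ε
  ε∈ = 0≤ε , ℚP.≤-trans (ℚP.≤-trans (ℚP.≤-reflexive (sym (ℚP.*-identityˡ ε)))
    (*-monoʳ-≤-0≤ 0≤ε (ℕtoℚ-mono-≤ (s≤s (z≤n {3}))))) 4ε≤1

  valid-big : ∀ c → ValidItem (big c)
  valid-big c = ℚP.≤-refl , ℚP.positive⁻¹ 1ℚ , spike-InUnit c {1ℚ - (ε + ε)} {0ℚ}
    ( ≤-via-difference ((1ℚ - ℕtoℚ 4 * ε) + (ε + ε))
        (solve 1 (λ e → (con 1ℚ :- (e :+ e)) :- con 0ℚ := (con 1ℚ :- con (ℕtoℚ 4) :* e) :+ (e :+ e)) refl ε)
        (ℚP.+-mono-≤ 1-4ε≥0 (ℚP.+-mono-≤ 0≤ε 0≤ε))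
    , ≤-via-difference (ε + ε) (solve 1 (λ e → con 1ℚ :- (con 1ℚ :- (e :+ e)) := e :+ e) refl ε) (ℚP.+-mono-≤ 0≤ε 0≤ε))
    (ℚP.≤-refl , 0≤1)

  valid-fil : ∀ c → ValidItem (fil c)
  valid-fil c = ℚP.≤-refl , ℚP.positive⁻¹ 1ℚ , spike-InUnit c {ε} {ε + ε + ε} ε∈
    ( ℚP.+-mono-≤ (ℚP.+-mono-≤ 0≤ε 0≤ε) 0≤ε
    , ≤-via-difference ((1ℚ - ℕtoℚ 4 * ε) + ε)
        (solve 1 (λ e → con 1ℚ :- (e :+ e :+ e) := (con 1ℚ :- con (ℕtoℚ 4) :* e) :+ e) refl ε)
        (ℚP.+-mono-≤ 1-4ε≥0 0≤ε))

  valid-tiny : ValidItem tiny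
  valid-tiny = 0≤s , s<s+μ , VecAllP.lookup⁻ (λ i → subst InUnit (sym (lookup-tinyS i)) ε∈)

  valid : ValidInstance R
  valid = AllP.++⁺ (AllP.concat⁺ (AllP.replicate⁺ M (All-pairs valid-big valid-fil cs))) (AllP.replicate⁺ T valid-tiny)
        , arrivals-sorted R ((ℕ.pred (length R₀) , 0ℚ) ∷ (ℕ.pred T , s) ∷ []) arrivals (0≤s ∷ [-])
    where
    arrivals : map arr R ≡ expand ((ℕ.pred (length R₀) , 0ℚ) ∷ (ℕ.pred T , s) ∷ [])
    arrivals = trans (ListP.map-++ arr R₀ (replicate T tiny)) (cong₂ _++_
      (trans (All-≡⇒replicate (AllP.map⁺ (All.map proj₁ pair-times))) (cong (λ k → replicate k 0ℚ) (ListP.length-map arr R₀)))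
      (trans (ListP.map-replicate arr T tiny) (sym (ListP.++-identityʳ (replicate T s)))))

  duration-tiny : duration tiny ≡ μ
  duration-tiny = solve 2 (λ s m → (s :+ m) :- s := m) refl s μ

  ratio : DurationRatio R μ
  ratio = durationRatio-1-μ R μ 1≤μ
    (AllP.++⁺ (AllP.concat⁺ (AllP.replicate⁺ M (All-pairs (λ _ → inj₁ refl) (λ _ → inj₁ refl) cs)))
              (AllP.replicate⁺ T (inj₂ duration-tiny)))
    (MemP.∈-++⁺ʳ R₀ (here refl)) (here refl) duration-tiny refl

  competitive : ∀ δ → 0ℚ ≤ δ → ℕtoℚ d * ((μ + 1ℚ) * (μ + 1ℚ)) + ℕtoℚ d ≤ δ * ℕtoℚ M →
    ((μ + 1ℚ) * ℕtoℚ d - δ) * OPT R ≤ costMF R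
  competitive δ 0≤δ X≤δM = *-≤-via-upper-bound {(μ + 1ℚ) * D - δ} (OPT-nonNeg R) OPT≤ 0≤cost
    (ℚP.≤-trans (≤-via-difference slack
      (solve 5 (λ m D μ s δ → m :* D :* (s :+ μ) :- ((μ :+ con 1ℚ) :* D :- δ) :* (m :+ (s :+ μ))
                := (δ :* m :- (D :* ((μ :+ con 1ℚ) :* (μ :+ con 1ℚ)) :+ D))
                   :+ (D :* (con 1ℚ :- m :* (con 1ℚ :- s)) :+ ((μ :+ con 1ℚ) :* D :* (con 1ℚ :- s) :+ δ :* (s :+ μ))))
         refl (ℕtoℚ M) D μ s δ)
      (ℚP.+-mono-≤ (p≤q⇒0≤q-p X≤δM) (ℚP.+-mono-≤ (*-nonNeg (0≤ℕtoℚ d) (p≤q⇒0≤q-p M[1-s]≤1))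
        (ℚP.+-mono-≤ (*-nonNeg (*-nonNeg 0≤μ+1 (0≤ℕtoℚ d)) (p≤q⇒0≤q-p (ℚP.<⇒≤ s<1))) (*-nonNeg 0≤δ 0≤s+μ)))))
      (ℚP.≤-reflexive (sym cost≡′)))
    where
    D : ℚ
    D = ℕtoℚ d
    slack : ℚ
    slack = (δ * ℕtoℚ M - (D * ((μ + 1ℚ) * (μ + 1ℚ)) + D))
          + (D * (1ℚ - ℕtoℚ M * (1ℚ - s)) + ((μ + 1ℚ) * D * (1ℚ - s) + δ * (s + μ)))
    0≤μ+1 : 0ℚ ≤ μ + 1ℚ
    0≤μ+1 = ℚP.+-mono-≤ (ℚP.<⇒≤ 0<μ) 0≤1
    0≤s+μ : 0ℚ ≤ s + μ
    0≤s+μ = ℚP.+-mono-≤ 0≤s (ℚP.<⇒≤ 0<μ)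
    cost≡′ : costMF R ≡ ℕtoℚ M * D * (s + μ)
    cost≡′ = trans cost≡ (cong (_* (s + μ)) (ℕtoℚ-* M d))
    0≤cost : 0ℚ ≤ costMF R
    0≤cost = ℚP.≤-trans (*-nonNeg (*-nonNeg (0≤ℕtoℚ M) (0≤ℕtoℚ d)) 0≤s+μ) (ℚP.≤-reflexive (sym cost≡′))

dimension-lowerBound : ∀ d → 1 ℕ.≤ d → ∀ μ → 1ℚ ≤ μ → ∀ δ → 0ℚ < δ → LowerBoundWitness d μ ((μ + 1ℚ) * ℕtoℚ d) δ
dimension-lowerBound (suc d′) _ μ 1≤μ δ 0<δ = R , valid , ratio , competitive δ (ℚP.<⇒≤ 0<δ) X≤δM
  where
  X : ℚ
  X = ℕtoℚ (suc d′) * ((μ + 1ℚ) * (μ + 1ℚ)) + ℕtoℚ (suc d′)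
  k : ℕ
  k = proj₁ (archimedean-suc 0<δ X)
  X≤δM : X ≤ δ * ℕtoℚ (suc k)
  X≤δM = proj₂ (archimedean-suc 0<δ X)
  η : ℚ
  η = 1/suc (suc k)
  0<1-η : 0ℚ < 1ℚ - η
  0<1-η = p<q⇒0<q-p (1/suc-suc<1 k)
  1-η<1 : 1ℚ - η < 1ℚ
  1-η<1 = <-via-difference η (solve 1 (λ x → con 1ℚ :- (con 1ℚ :- x) := x) refl η) (0<1/suc (suc k))
  M[1-s]≤1 : ℕtoℚ (suc k) * (1ℚ - (1ℚ - η)) ≤ 1ℚ
  M[1-s]≤1 = ℚP.≤-trans (ℚP.≤-reflexive (cong (ℕtoℚ (suc k) *_) (solve 1 (λ x → con 1ℚ :- (con 1ℚ :- x) := x) refl η)))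
    (*1/suc-≤1 (suc k) (ℕP.n≤1+n (suc k)))
  K : ℕ
  K = ℕ.pred (suc k ℕ.* suc d′ ℕ.* 4)
  Md4ε≡1 : ℕtoℚ (suc k) * ℕtoℚ (suc d′) * (ℕtoℚ 4 * 1/suc K) ≡ 1ℚ
  Md4ε≡1 = begin
    ℕtoℚ (suc k) * ℕtoℚ (suc d′) * (ℕtoℚ 4 * 1/suc K)  ≡⟨ ℚP.*-assoc (ℕtoℚ (suc k) * ℕtoℚ (suc d′)) (ℕtoℚ 4) (1/suc K) ⟨
    ℕtoℚ (suc k) * ℕtoℚ (suc d′) * ℕtoℚ 4 * 1/suc K    ≡⟨ cong (λ x → x * ℕtoℚ 4 * 1/suc K) (ℕtoℚ-* (suc k) (suc d′)) ⟨
    ℕtoℚ (suc k ℕ.* suc d′) * ℕtoℚ 4 * 1/suc K         ≡⟨ cong (_* 1/suc K) (ℕtoℚ-* (suc k ℕ.* suc d′) 4) ⟨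
    ℕtoℚ (suc K) * 1/suc K                             ≡⟨ ℕtoℚ-suc*1/suc K ⟩
    1ℚ                                                 ∎
    where open ≡-Reasoning
  open DimensionFamily d′ k μ 1≤μ (1ℚ - η) 0<1-η 1-η<1 M[1-s]≤1 (1/suc K) (0<1/suc K) Md4ε≡1

μ+1≤2μ : ∀ {μ} → 1ℚ ≤ μ → (μ + 1ℚ) * ℕtoℚ 1 ≤ ℕtoℚ 2 * μ
μ+1≤2μ {μ} 1≤μ = begin
  (μ + 1ℚ) * ℕtoℚ 1  ≡⟨ ℚP.*-identityʳ (μ + 1ℚ) ⟩
  μ + 1ℚ             ≤⟨ ℚP.+-monoʳ-≤ μ 1≤μ ⟩
  μ + μ              ≡⟨ solve 1 (λ m → m :+ m := con (ℕtoℚ 2) :* m) refl μ ⟩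
  ℕtoℚ 2 * μ         ∎
  where open ℚP.≤-Reasoning

2μ≤[μ+1]d : ∀ {μ} d → 0ℚ ≤ μ → ℕtoℚ 2 * μ ≤ (μ + 1ℚ) * ℕtoℚ (2 ℕ.+ d)
2μ≤[μ+1]d {μ} d 0≤μ = begin
  ℕtoℚ 2 * μ              ≡⟨ ℚP.+-identityʳ (ℕtoℚ 2 * μ) ⟨
  ℕtoℚ 2 * μ + 0ℚ         ≤⟨ ℚP.+-monoʳ-≤ (ℕtoℚ 2 * μ) (0≤ℕtoℚ 2) ⟩
  ℕtoℚ 2 * μ + ℕtoℚ 2     ≡⟨ solve 1 (λ m → con (ℕtoℚ 2) :* m :+ con (ℕtoℚ 2) := (m :+ con 1ℚ) :* con (ℕtoℚ 2)) refl μ ⟩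
  (μ + 1ℚ) * ℕtoℚ 2       ≤⟨ *-monoˡ-≤-0≤ (ℚP.+-mono-≤ 0≤μ 0≤1) (ℕtoℚ-mono-≤ (s≤s (s≤s (z≤n {d})))) ⟩
  (μ + 1ℚ) * ℕtoℚ (2 ℕ.+ d) ∎
  where open ℚP.≤-Reasoning

theorem7 : (d : ℕ) → 1 Data.Nat.≤ d → (μ : ℚ) → 1ℚ ≤ μ → (δ : ℚ) → 0ℚ < δ →
    ∃[ R ] (ValidInstance {d} R × DurationRatio R μ
      × ((((ℕtoℚ 2 * μ) ⊔ ((μ + 1ℚ) * ℕtoℚ d)) - δ) * OPT R ≤ costMF R))
theorem7 zero () μ 1≤μ δ 0<δ
theorem7 (suc zero) _ μ 1≤μ δ 0<δ =
  subst (λ ρ → LowerBoundWitness 1 μ ρ δ) (sym (ℚP.p≥q⇒p⊔q≡p (μ+1≤2μ 1≤μ)))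
    (twoμ-lowerBound μ 1≤μ δ 0<δ)
theorem7 (suc (suc d)) 1≤2+d μ 1≤μ δ 0<δ =
  subst (λ ρ → LowerBoundWitness (2 ℕ.+ d) μ ρ δ) (sym (ℚP.p≤q⇒p⊔q≡q (2μ≤[μ+1]d d (ℚP.≤-trans 0≤1 1≤μ))))
    (dimension-lowerBound (2 ℕ.+ d) 1≤2+d μ 1≤μ δ 0<δ)
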